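{- (i) If $n\geq 3$ is odd, then $\lambda(K_2\times C_n)=\lambda_2(K_2\times C_n)=\lambda_3(K_2\times C_n)=2$. (ii) If $n\geq 5$, then $\lambda(K_2\times K_n)=n-1$, $\lambda_2(K_2\times K_n)=2n-4$ and $\lambda_3(K_2\times K_n)=3n-7$. (iii) If $n\geq 5$, then $\lambda(K_2\times T_n)=n$, $\lambda_2(K_2\times T_n)=2n-2$ and $\lambda_3(K_2\times T_n)=3n-4$.
   Context: $C_n$, $K_n$ are the cycle and complete graph on $n$ vertices; the total graph $T_n$ is obtained from $K_n$ by attaching a loop at every vertex. The direct product $G\times H$ has vertex set $V(G)\times V(H)$, with $(u_1,v_1)$ adjacent to $(u_2,v_2)$ iff $u_1u_2\in E(G)$ and $v_1v_2\in E(H)$ (for $H=T_n$, this holds for all $v_1,v_2$ including $v_1=v_2$). $\lambda(X)$ is the edge-connectivity of $X$. For $j\ge1$, a $j$-restricted edge-cut of $X$ is an edge set $S$ such that $X-S$ is disconnected and every component of $X-S$ has at least $j$ vertices; $\lambda_j(X)$ is the minimum size of such a cut ($+\infty$ if none). -}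

module Defs where

open import Data.Nat using (ℕ; zero; suc; _+_; _*_; _<ᵇ_; _≡ᵇ_; _%_; _≤_; _<_)
open import Data.Nat.Properties using ()
open import Data.Bool using (Bool; true; false; _∧_; _∨_; not; T; if_then_else_)
open import Data.Fin using (Fin; toℕ; quotient; remainder)
open import Data.List using (List; []; _∷_; map; allFin)
open import Data.Nat.ListAction using (sum)
open import Data.Product using (Σ; ∃; _×_; _,_)
open import Function.Definitions using (Injective)
open import Relation.Binary.PropositionalEquality using (_≡_)
open import Relation.Nullary using (¬_)

-- A (finite, undirected) graph on the vertex set Fin N, given by a
-- Boolean adjacency relation which is symmetric.  Loops are allowed
-- (adj v v = true), as needed for the total graph T_n.
record Graph (N : ℕ) : Set where
  field
    adj : Fin N → Fin N → Bool
    adj-sym : ∀ u v → adj u v ≡ adj v u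
open Graph public

cycleAdj : (n : ℕ) → Fin n → Fin n → Bool
cycleAdj zero () _
cycleAdj (suc k) i j =
  (((suc (toℕ i)) % suc k) ≡ᵇ toℕ j) ∨ (((suc (toℕ j)) % suc k) ≡ᵇ toℕ i)

∨-comm' : ∀ a b → (a ∨ b) ≡ (b ∨ a)
∨-comm' false false = _≡_.refl
∨-comm' false true = _≡_.refl
∨-comm' true false = _≡_.refl
∨-comm' true true = _≡_.refl

C : (n : ℕ) → Graph n
C zero = record { adj = λ () ; adj-sym = λ () }
C (suc k) = record
  { adj = cycleAdj (suc k)
  ; adj-sym = λ i j → ∨-comm' ((suc (toℕ i) % suc k) ≡ᵇ toℕ j) ((suc (toℕ j) % suc k) ≡ᵇ toℕ i) }

K : (n : ℕ) → Graph n
K n = record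
  { adj = λ i j → not (toℕ i ≡ᵇ toℕ j)
  ; adj-sym = λ i j → symNeq (toℕ i) (toℕ j) }
  where
  symNeq : ∀ a b → not (a ≡ᵇ b) ≡ not (b ≡ᵇ a)
  symNeq zero zero = _≡_.refl
  symNeq zero (suc b) = _≡_.refl
  symNeq (suc a) zero = _≡_.refl
  symNeq (suc a) (suc b) = symNeq a b

-- Total graph T_n: K_n with a loop at every vertex.
T' : (n : ℕ) → Graph n
T' n = record { adj = λ _ _ → true ; adj-sym = λ _ _ → _≡_.refl }

∧-comm' : ∀ a b → (a ∧ b) ≡ (b ∧ a)
∧-comm' false false = _≡_.refl
∧-comm' false true = _≡_.refl
∧-comm' true false = _≡_.refl
∧-comm' true true = _≡_.refl

-- Direct product G × H on Fin (m * n); vertex x corresponds to the pair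
-- (quotient n x , remainder n x) ∈ Fin m × Fin n (a bijection, Data.Fin).
_⊗_ : ∀ {m n} → Graph m → Graph n → Graph (m * n)
_⊗_ {m} {n} G H = record
  { adj = λ x y → adj G (quotient n x) (quotient n y) ∧ adj H (remainder {m} n x) (remainder {m} n y)
  ; adj-sym = λ x y → prf x y }
  where
  open import Relation.Binary.PropositionalEquality using (cong₂)
  prf : ∀ x y → (adj G (quotient n x) (quotient n y) ∧ adj H (remainder {m} n x) (remainder {m} n y))
              ≡ (adj G (quotient n y) (quotient n x) ∧ adj H (remainder {m} n y) (remainder {m} n x))
  prf x y = cong₂ _∧_ (adj-sym G (quotient n x) (quotient n y)) (adj-sym H (remainder {m} n x) (remainder {m} n y))

record EdgeSet {N : ℕ} (X : Graph N) : Set where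
  field
    sel : Fin N → Fin N → Bool
    sel-sym : ∀ u v → sel u v ≡ sel v u
    sel-⊆ : ∀ u v → T (sel u v) → T (adj X u v)
open EdgeSet public

-- Number of edges in S: unordered pairs {u,v} (u ≠ v) in S, counted once
-- via toℕ u < toℕ v, plus loops in S.
boolToℕ : Bool → ℕ
boolToℕ true = 1
boolToℕ false = 0

∣_∣ₑ : ∀ {N} {X : Graph N} → EdgeSet X → ℕ
∣_∣ₑ {N} S = sum (map (λ u → sum (map (λ v →
   boolToℕ (sel S u v ∧ ((toℕ u <ᵇ toℕ v) ∨ (toℕ u ≡ᵇ toℕ v)))) (allFin N))) (allFin N))

_─_ : ∀ {N} (X : Graph N) → EdgeSet X → Graph N
X ─ S = record
  { adj = λ u v → adj X u v ∧ not (sel S u v)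
  ; adj-sym = λ u v → Relation.Binary.PropositionalEquality.cong₂ _∧_ (adj-sym X u v)
                         (Relation.Binary.PropositionalEquality.cong not (sel-sym S u v)) }
  where import Relation.Binary.PropositionalEquality

data Reach {N : ℕ} (X : Graph N) : Fin N → Fin N → Set where
  here : ∀ {u} → Reach X u u
  step : ∀ {u v w} → T (adj X u v) → Reach X v w → Reach X u w

Disconnected : ∀ {N} → Graph N → Set
Disconnected {N} X = Σ (Fin N) λ u → Σ (Fin N) λ v → ¬ Reach X u v

-- Every component of X has at least j vertices: the component of each
-- vertex v contains j distinct vertices.
ComponentsAtLeast : ∀ {N} → Graph N → ℕ → Set
ComponentsAtLeast {N} X j =
  ∀ (v : Fin N) → Σ (Fin j → Fin N) λ f → Injective _≡_ _≡_ f × (∀ i → Reach X v (f i))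

IsEdgeCut : ∀ {N} (X : Graph N) → EdgeSet X → Set
IsEdgeCut X S = Disconnected (X ─ S)

IsRestrictedEdgeCut : ∀ {N} (X : Graph N) → ℕ → EdgeSet X → Set
IsRestrictedEdgeCut X j S = Disconnected (X ─ S) × ComponentsAtLeast (X ─ S) j

EdgeConnEq : ∀ {N} → Graph N → ℕ → Set
EdgeConnEq X k =
  (Σ (EdgeSet X) λ S → IsEdgeCut X S × ∣ S ∣ₑ ≡ k)
  × (∀ S → IsEdgeCut X S → k ≤ ∣ S ∣ₑ)

-- λ_j(X) = k (with k finite): k is the minimum size of a j-restricted edge-cut.
RestrictedEdgeConnEq : ∀ {N} → Graph N → ℕ → ℕ → Set
RestrictedEdgeConnEq X j k =
  (Σ (EdgeSet X) λ S → IsRestrictedEdgeCut X j S × ∣ S ∣ₑ ≡ k)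
  × (∀ S → IsRestrictedEdgeCut X j S → k ≤ ∣ S ∣ₑ)

Odd : ℕ → Set
Odd n = Σ ℕ λ k → n ≡ suc (2 * k)

-- A j-restricted edge cut S separates two vertices u and v. The set A of vertices reachable
-- from u in X − S and its complement both contain at least j vertices, and every edge leaving
-- A lies in S. So λⱼ(X) ≥ k as soon as every bipartition whose sides have at least j vertices
-- has at least k edges between its sides (an isoperimetric bound), and the edges leaving one
-- such set A show λⱼ(X) ≤ k.
--
-- In K₂ × H let a, b count the vertices of A in the two layers and a′, b′ those of the
-- complement, so a + a′ = b + b′ = n. For H = Tₙ the boundary is ab′ + ba′, which is at least
-- (a + b)(a′ + b′)/2, and (a + b)(a′ + b′) ≥ 2jn − j² when both factors are at least j. For
-- H = Kₙ the boundary is smaller by the number of split twins (vertices of H whose two copies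
-- are separated), at most min(a + b, a′ + b′). The sets {L 0}, {L 0, R 1} and {L 0, L 1, R 2}
-- attain these bounds. For odd n, K₂ × Cₙ is a single cycle of length 2n: every bipartition
-- of a cycle has at least two boundary edges, and three consecutive vertices have exactly two.

module Submission where

open import Defs
open import Data.Nat
  using (ℕ; zero; suc; _+_; _*_; _∸_; _≤_; _<_; z≤n; s≤s; _<ᵇ_; _≤ᵇ_; _≡ᵇ_; _%_; _/_; _≤?_; _<?_; NonZero; parity)
open import Data.Nat.Properties hiding (suc-injective) renaming (_≟_ to _≟ℕ_)
open import Data.Nat.DivMod
  using ( _mod_; %-distribˡ-+; m<n⇒m%n≡m; m%n<n; m≤n⇒[n∸m]%m≡n%m; [m+n]%n≡m%n; [m+kn]%n≡m%n
        ; m%n%n≡m%n; m≡m%n+[m/n]*n; m∣n⇒o%n%m≡o%m; n%n≡0)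
open import Data.Nat.Divisibility using (divides)
open import Data.Nat.Tactic.RingSolver using (solve-∀)
import Data.Nat.ListAction as List
open import Data.Parity.Base as ℙ using (Parity; 0ℙ; 1ℙ; _⁻¹)
open import Data.Parity.Properties as ℙₚ
  using (p≢p⁻¹; suc-homo-⁻¹; +-homo-+; *-homo-*; ⁻¹-involutive) renaming (_≟_ to _≟ℙ_)
open import Data.Bool using (Bool; true; false; not; _∧_; _∨_; _xor_; T; if_then_else_)
open import Data.Bool.Properties
  using (T-∧; T-∨; T-≡; T-not-≡; xor-comm; ∧-identityʳ; ∧-zeroʳ) renaming (_≟_ to _≟ᵇ_)
open import Data.Fin using (Fin; zero; suc; toℕ; combine; remQuot; quotient; remainder; inject≤; _↑ˡ_; _↑ʳ_; #_)
open import Data.Fin.Properties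
  using ( _≟_; suc-injective; toℕ-injective; inject≤-injective; remQuot-combine; combine-remQuot
        ; combine-injectiveˡ; combine-injectiveʳ; toℕ-fromℕ<; toℕ<n)
open import Data.List using (map; allFin; tabulate)
open import Data.List.Properties using (map-tabulate; map-cong)
open import Data.Vec.Functional using (Vector; []; _∷_)
open import Data.Product using (Σ; ∃; _×_; _,_; proj₁; proj₂; uncurry)
open import Data.Sum using (_⊎_; inj₁; inj₂)
open import Data.Empty using (⊥; ⊥-elim)
open import Data.Unit using (tt)
open import Function using (_∘_; id; Equivalence)
open import Function.Definitions using (Injective)
open import Relation.Nullary using (¬_; Dec; yes; no; does; contradiction)
open import Relation.Nullary.Decidable
  using (isYes; decidable-stable; ¬¬-excluded-middle; fromWitness; toWitness; fromWitnessFalse; toWitnessFalse)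
open import Relation.Binary.PropositionalEquality
open import Algebra.Properties.CommutativeSemigroup +-commutativeSemigroup using (interchange; x∙yz≈y∙xz)
open import Algebra.Properties.Semiring.Sum +-*-semiring
  using (sum; sum-syntax; sum-cong-≗; ∑-distrib-+; ∑-comm; *-distribˡ-sum; sum-replicate-zero)

open Equivalence using (to; from)

T⇒1≤boolToℕ : ∀ {b} → T b → 1 ≤ boolToℕ b
T⇒1≤boolToℕ {true} _ = ≤-refl

clash : ∀ {b} → b ≡ true → b ≡ false → ⊥
clash refl ()

≢true : ∀ {b} → b ≢ true → T (not b)
≢true {false} _  = tt
≢true {true}  ne = ne refl

≢false : ∀ {b} → b ≢ false → T b
≢false {true}  _  = tt
≢false {false} ne = ne refl

xor-cases : ∀ a b → T (a xor b) → (T a × T (not b)) ⊎ (T b × T (not a))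
xor-cases true  false _ = inj₁ (tt , tt)
xor-cases false true  _ = inj₂ (tt , tt)

∧-≤ˡ : ∀ x y → boolToℕ (x ∧ y) ≤ boolToℕ x
∧-≤ˡ false y     = z≤n
∧-≤ˡ true  false = z≤n
∧-≤ˡ true  true  = ≤-refl

∧-≤ʳ : ∀ x y → boolToℕ (x ∧ y) ≤ boolToℕ y
∧-≤ʳ false y = z≤n
∧-≤ʳ true  y = ≤-refl

∧-≤-middle : ∀ a b c → boolToℕ (a ∧ b ∧ c) ≤ boolToℕ b
∧-≤-middle false b     c     = z≤n
∧-≤-middle true  false c     = z≤n
∧-≤-middle true  true  false = z≤n
∧-≤-middle true  true  true  = ≤-refl

∧-last : ∀ {a b c} → boolToℕ (a ∧ b ∧ c) ≢ 0 → T c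
∧-last {true}  {true}  {true}  _  = tt
∧-last {false}                 ≢0 = contradiction refl ≢0
∧-last {true}  {false}         ≢0 = contradiction refl ≢0
∧-last {true}  {true}  {false} ≢0 = contradiction refl ≢0


-- (s − j)(t − j) ≥ 0
product-≥ : ∀ j s t → j ≤ s → j ≤ t → j * (s + t) ≤ s * t + j * j
product-≥ j s t j≤s j≤t with a , refl ← m≤n⇒∃[o]m+o≡n j≤s | b , refl ← m≤n⇒∃[o]m+o≡n j≤t =
  subst (j * ((j + a) + (j + b)) ≤_) (sym (expand j a b)) (m≤m+n _ (a * b))
  where
  expand : ∀ j a b → (j + a) * (j + b) + j * j ≡ j * ((j + a) + (j + b)) + a * b
  expand = solve-∀

private
  cross-≥-ordered : ∀ a a′ b b′ → a + a′ ≡ b + b′ → b ≤ a → (a + b) * (a′ + b′) ≤ 2 * (a * b′ + b * a′)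
  cross-≥-ordered _ a′ b b′ e b≤a with d , refl ← m≤n⇒∃[o]m+o≡n b≤a
    with refl ← +-cancelˡ-≡ b (d + a′) b′ (trans (sym (+-assoc b d a′)) e) =
    subst ((b + d + b) * (a′ + (d + a′)) ≤_) (sym (expand b d a′)) (m≤m+n _ (d * d))
    where
    expand : ∀ b d a′ → 2 * ((b + d) * (d + a′) + b * a′) ≡ (b + d + b) * (a′ + (d + a′)) + d * d
    expand = solve-∀

-- 2(ab′ + ba′) − (a + b)(a′ + b′) = (a − b)², because a − b = b′ − a′.
cross-≥ : ∀ a a′ b b′ → a + a′ ≡ b + b′ → (a + b) * (a′ + b′) ≤ 2 * (a * b′ + b * a′)
cross-≥ a a′ b b′ e with ≤-total b a
... | inj₁ b≤a = cross-≥-ordered a a′ b b′ e b≤a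
... | inj₂ a≤b = subst₂ _≤_ (cong₂ _*_ (+-comm b a) (+-comm b′ a′)) (cong (2 *_) (+-comm (b * a′) (a * b′)))
                        (cross-≥-ordered b b′ a a′ (sym e) a≤b)

-- product-≥ applied to s and t ∸ 2; the term 2 * s accounts for the split twins of K₂ × Kₙ.
product-≥-shifted : ∀ j s t c → j ≤ s → j + 2 ≤ t → s * t ≤ 2 * c + 2 * s → j * (s + t) ≤ 2 * c + j * j + 2 * j
product-≥-shifted j s t c j≤s j+2≤t st≤ with u , refl ← m≤n⇒∃[o]m+o≡n (≤-trans (m≤n+m 2 j) j+2≤t) = begin
  j * (s + (2 + u))       ≡⟨ shift j s u ⟩
  j * (s + u) + 2 * j     ≤⟨ +-monoˡ-≤ (2 * j) (product-≥ j s u j≤s j≤u) ⟩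
  s * u + j * j + 2 * j   ≤⟨ +-monoˡ-≤ (2 * j) (+-monoˡ-≤ (j * j) su≤2c) ⟩
  2 * c + j * j + 2 * j   ∎
  where
  open ≤-Reasoning
  shift : ∀ j s u → j * (s + (2 + u)) ≡ j * (s + u) + 2 * j
  shift = solve-∀
  j≤u : j ≤ u
  j≤u = +-cancelˡ-≤ 2 j u (subst (_≤ 2 + u) (+-comm j 2) j+2≤t)
  su≤2c : s * u ≤ 2 * c
  su≤2c = +-cancelˡ-≤ (2 * s) (s * u) (2 * c) (begin
    2 * s + s * u  ≡⟨ distrib s u ⟩
    s * (2 + u)    ≤⟨ st≤ ⟩
    2 * c + 2 * s  ≡⟨ +-comm (2 * c) (2 * s) ⟩
    2 * s + 2 * c  ∎)
    where
    distrib : ∀ s u → 2 * s + s * u ≡ s * (2 + u)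
    distrib = solve-∀

halve-∸ : ∀ m c d → 2 * m ≤ 2 * c + suc (2 * d) → m ∸ d ≤ c
halve-∸ m c d 2m≤ = m≤n+o⇒m∸n≤o m d (subst (m ≤_) (+-comm c d) (<⇒≤pred (*-cancelˡ-< 2 m (suc (c + d)) (begin-strict
  2 * m                 ≤⟨ 2m≤ ⟩
  2 * c + suc (2 * d)   ≡⟨ odd c d ⟩
  suc (2 * (c + d))     <⟨ n<1+n _ ⟩
  suc (suc (2 * (c + d))) ≡⟨ even (c + d) ⟨
  2 * suc (c + d)       ∎))))
  where
  open ≤-Reasoning
  odd : ∀ c d → 2 * c + suc (2 * d) ≡ suc (2 * (c + d))
  odd = solve-∀
  even : ∀ x → 2 * suc x ≡ suc (suc (2 * x))
  even = solve-∀

larger-≥-half : ∀ s t n → s ≤ t → s + t ≡ 2 * n → n ≤ t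
larger-≥-half s t n s≤t s+t≡2n = *-cancelˡ-≤ 2 (begin
  2 * n   ≡⟨ s+t≡2n ⟨
  s + t   ≤⟨ +-monoˡ-≤ t s≤t ⟩
  t + t   ≡⟨ cong (t +_) (+-identityʳ t) ⟨
  2 * t   ∎)
  where open ≤-Reasoning

+-%-cong : ∀ c {a b N} .{{_ : NonZero N}} → a % N ≡ b % N → (c + a) % N ≡ (c + b) % N
+-%-cong c {a} {b} {N} a≡b = begin
  (c + a) % N            ≡⟨ %-distribˡ-+ c a N ⟩
  (c % N + a % N) % N    ≡⟨ cong (λ r → (c % N + r) % N) a≡b ⟩
  (c % N + b % N) % N    ≡⟨ %-distribˡ-+ c b N ⟨
  (c + b) % N            ∎
  where open ≡-Reasoning

2+-%-≢ : ∀ t {N} .{{_ : NonZero N}} → 3 ≤ N → (2 + t) % N ≢ t % N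
2+-%-≢ t {N} 3≤N 2+t≡t = wraps (t % N) (m%n<n t N) (begin
  (2 + t % N) % N        ≡⟨ cong (λ k → (k + t % N) % N) (m<n⇒m%n≡m {m = 2} 3≤N) ⟨
  (2 % N + t % N) % N    ≡⟨ %-distribˡ-+ 2 t N ⟨
  (2 + t) % N            ≡⟨ 2+t≡t ⟩
  t % N                  ∎)
  where
  open ≡-Reasoning
  wraps : ∀ r → r < N → (2 + r) % N ≢ r
  wraps r r<N 2+r≡r with 2 + r <? N
  ... | yes 2+r<N = m≢1+n+m r (sym (trans (sym (m<n⇒m%n≡m 2+r<N)) 2+r≡r))
  ... | no  2+r≮N = <-irrefl refl (≤-trans 3≤N (≤-reflexive N≡2))
    where
    N≤2+r = ≮⇒≥ 2+r≮N
    wrapped : (2 + r) % N ≡ 2 + r ∸ N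
    wrapped = trans (sym (m≤n⇒[n∸m]%m≡n%m N≤2+r))
                    (m<n⇒m%n≡m (≤-<-trans (∸-monoʳ-≤ (2 + r) 3≤N) (≤-<-trans (m∸n≤m r 1) r<N)))
    N≡2 : N ≡ 2
    N≡2 = +-cancelʳ-≡ r N 2 (trans (+-comm N r) (trans (cong (_+ N) (sym (trans (sym wrapped) 2+r≡r))) (m∸n+n≡m N≤2+r)))

suc-%-injective : ∀ {a b M} → suc a % suc M ≡ suc b % suc M → a % suc M ≡ b % suc M
suc-%-injective {a} {b} {M} e = begin
  a % suc M              ≡⟨ [m+n]%n≡m%n a (suc M) ⟨
  (a + suc M) % suc M    ≡⟨ cong (_% suc M) (shift a M) ⟩
  (M + suc a) % suc M    ≡⟨ +-%-cong M e ⟩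
  (M + suc b) % suc M    ≡⟨ cong (_% suc M) (shift b M) ⟨
  (b + suc M) % suc M    ≡⟨ [m+n]%n≡m%n b (suc M) ⟩
  b % suc M              ∎
  where
  open ≡-Reasoning
  shift : ∀ a M → a + suc M ≡ M + suc a
  shift = solve-∀

∸-≡ : ∀ {a b c} → a ≡ b + c → a ∸ b ≡ c
∸-≡ {b = b} {c} a≡b+c = trans (cong (_∸ b) a≡b+c) (m+n∸m≡n b c)

interval : ℕ → ℕ → ℕ → Bool
interval lo hi x = (lo ≤ᵇ x) ∧ (x <ᵇ hi)

interval-1-4-∋ : ∀ k → interval 1 4 k ≡ true → k ≡ 1 ⊎ k ≡ 2 ⊎ k ≡ 3
interval-1-4-∋ 1 _ = inj₁ refl
interval-1-4-∋ 2 _ = inj₂ (inj₁ refl)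
interval-1-4-∋ 3 _ = inj₂ (inj₂ refl)

interval-1-4-∌ : ∀ k → interval 1 4 k ≡ false → k ≡ 0 ⊎ 4 ≤ k
interval-1-4-∌ 0                         _ = inj₁ refl
interval-1-4-∌ (suc (suc (suc (suc k)))) _ = inj₂ (s≤s (s≤s (s≤s (s≤s z≤n))))

interval-1-4-≥4 : ∀ k → 4 ≤ k → interval 1 4 k ≡ false
interval-1-4-≥4 (suc (suc (suc (suc k)))) (s≤s (s≤s (s≤s (s≤s _)))) = refl

sum-mono-≤ : ∀ {N} {f g : Vector ℕ N} → (∀ i → f i ≤ g i) → sum f ≤ sum g
sum-mono-≤ {zero}  f≤g = z≤n
sum-mono-≤ {suc N} f≤g = +-mono-≤ (f≤g zero) (sum-mono-≤ (f≤g ∘ suc))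

sum-const : ∀ N c → ∑[ i < N ] c ≡ N * c
sum-const zero    c = refl
sum-const (suc N) c = cong (c +_) (sum-const N c)

except : ∀ {N} → Fin N → Vector ℕ N → Vector ℕ N
except a f x = if does (x ≟ a) then 0 else f x

except-≢ : ∀ {N} {a x : Fin N} (f : Vector ℕ N) → x ≢ a → except a f x ≡ f x
except-≢ {a = a} {x} f x≢a with x ≟ a
... | yes x≡a = ⊥-elim (x≢a x≡a)
... | no  _   = refl

except-≤ : ∀ {N} (a : Fin N) (f : Vector ℕ N) x → except a f x ≤ f x
except-≤ a f x with x ≟ a
... | yes _ = z≤n
... | no  _ = ≤-refl

sum-except : ∀ {N} (a : Fin N) (f : Vector ℕ N) → sum f ≡ f a + sum (except a f)
sum-except zero    f = refl
sum-except (suc a) f = begin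
  f zero + sum (f ∘ suc)                          ≡⟨ cong (f zero +_) (sum-except a (f ∘ suc)) ⟩
  f zero + (f (suc a) + sum (except a (f ∘ suc))) ≡⟨ x∙yz≈y∙xz (f zero) (f (suc a)) _ ⟩
  f (suc a) + (f zero + sum (except a (f ∘ suc))) ∎
  where open ≡-Reasoning

sum-≥-single : ∀ {N} (a : Fin N) (f : Vector ℕ N) → f a ≤ sum f
sum-≥-single a f = ≤-trans (m≤m+n (f a) _) (≤-reflexive (sym (sum-except a f)))

sum-≥-pair : ∀ {N} {a b : Fin N} (f : Vector ℕ N) → b ≢ a → f a + f b ≤ sum f
sum-≥-pair {a = a} {b} f b≢a = begin
  f a + f b                  ≡⟨ cong (f a +_) (except-≢ f b≢a) ⟨
  f a + except a f b         ≤⟨ +-monoʳ-≤ (f a) (sum-≥-single b (except a f)) ⟩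
  f a + sum (except a f)     ≡⟨ sum-except a f ⟨
  sum f                      ∎
  where open ≤-Reasoning

sum-≥-injective : ∀ {N j} (f : Vector ℕ N) (g : Fin j → Fin N) →
                  Injective _≡_ _≡_ g → (∀ i → 1 ≤ f (g i)) → j ≤ sum f
sum-≥-injective {j = zero}  f g g-inj f∘g≥1 = z≤n
sum-≥-injective {j = suc j} f g g-inj f∘g≥1 = begin
  1 + j                            ≤⟨ +-mono-≤ (f∘g≥1 zero) rest ⟩
  f (g zero) + sum (except (g zero) f) ≡⟨ sum-except (g zero) f ⟨
  sum f                            ∎
  where
  open ≤-Reasoning
  rest : j ≤ sum (except (g zero) f)
  rest = sum-≥-injective (except (g zero) f) (g ∘ suc) (suc-injective ∘ g-inj)
           (λ i → subst (1 ≤_) (sym (except-≢ f (λ e → contradiction (g-inj e) λ ()))) (f∘g≥1 (suc i)))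

sum-≤-support : ∀ {N k} (f : Vector ℕ N) (xs : Fin k → Fin N) →
                (∀ x → f x ≢ 0 → ∃ λ i → xs i ≡ x) → sum f ≤ ∑[ i < k ] f (xs i)
sum-≤-support {N} {zero} f xs supp = ≤-reflexive (trans (sum-cong-≗ vanish) (sum-replicate-zero N))
  where
  vanish : ∀ x → f x ≡ 0
  vanish x with f x ≟ℕ 0
  ... | yes fx≡0 = fx≡0
  ... | no  fx≢0 with () ← supp x fx≢0
sum-≤-support {k = suc k} f xs supp = begin
  sum f
    ≡⟨ sum-except (xs zero) f ⟩
  f (xs zero) + sum (except (xs zero) f)
    ≤⟨ +-monoʳ-≤ (f (xs zero)) (sum-≤-support _ (xs ∘ suc) supp′) ⟩
  f (xs zero) + ∑[ i < k ] except (xs zero) f (xs (suc i))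
    ≤⟨ +-monoʳ-≤ (f (xs zero)) (sum-mono-≤ (λ i → except-≤ (xs zero) f (xs (suc i)))) ⟩
  f (xs zero) + ∑[ i < k ] f (xs (suc i)) ∎
  where
  open ≤-Reasoning
  supp′ : ∀ x → except (xs zero) f x ≢ 0 → ∃ λ i → xs (suc i) ≡ x
  supp′ x ne with x ≟ xs zero
  ... | yes _ = ⊥-elim (ne refl)
  ... | no x≢xs₀ with supp x ne
  ...   | zero  , xs₀≡x = ⊥-elim (x≢xs₀ (sym xs₀≡x))
  ...   | suc i , e     = i , e

sum-↑ : ∀ m n (f : Vector ℕ (m + n)) →
        sum f ≡ ∑[ i < m ] f (i ↑ˡ n) + ∑[ j < n ] f (m ↑ʳ j)
sum-↑ zero    n f = refl
sum-↑ (suc m) n f = trans (cong (f zero +_) (sum-↑ m n (f ∘ suc))) (sym (+-assoc (f zero) _ _))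

sum-combine : ∀ m n (f : Vector ℕ (m * n)) →
              sum f ≡ ∑[ s < m ] ∑[ i < n ] f (combine s i)
sum-combine zero    n f = refl
sum-combine (suc m) n f = trans (sum-↑ n (m * n) f) (cong (∑[ i < n ] f (i ↑ˡ (m * n)) +_) (sum-combine m n (f ∘ (n ↑ʳ_))))

count : ∀ {N} → (Fin N → Bool) → ℕ
count {N} p = ∑[ x < N ] boolToℕ (p x)

count-complement : ∀ {N} (p : Fin N → Bool) → count p + count (not ∘ p) ≡ N
count-complement {N} p = begin
  count p + count (not ∘ p)               ≡⟨ ∑-distrib-+ (boolToℕ ∘ p) (boolToℕ ∘ not ∘ p) ⟨
  ∑[ x < N ] (boolToℕ (p x) + boolToℕ (not (p x))) ≡⟨ sum-cong-≗ (λ x → one (p x)) ⟩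
  ∑[ x < N ] 1                            ≡⟨ sum-const N 1 ⟩
  N * 1                                   ≡⟨ *-identityʳ N ⟩
  N                                       ∎
  where
  open ≡-Reasoning
  one : ∀ b → boolToℕ b + boolToℕ (not b) ≡ 1
  one true  = refl
  one false = refl

count-∧ : ∀ {M N} (p : Fin M → Bool) (q : Fin N → Bool) →
          ∑[ i < M ] ∑[ j < N ] boolToℕ (p i ∧ q j) ≡ count p * count q
count-∧ {M} {N} p q = begin
  ∑[ i < M ] ∑[ j < N ] boolToℕ (p i ∧ q j)    ≡⟨ sum-cong-≗ (λ i → row (p i)) ⟩
  ∑[ i < M ] (count q * boolToℕ (p i))         ≡⟨ *-distribˡ-sum (count q) (boolToℕ ∘ p) ⟨
  count q * count p                            ≡⟨ *-comm (count q) (count p) ⟩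
  count p * count q                            ∎
  where
  open ≡-Reasoning
  row : ∀ b → ∑[ j < N ] boolToℕ (b ∧ q j) ≡ count q * boolToℕ b
  row true  = sym (*-identityʳ (count q))
  row false = trans (sum-const N 0) (trans (*-zeroʳ N) (sym (*-zeroʳ (count q))))

count-pos : ∀ {N} (p : Fin N → Bool) → 1 ≤ count p → ∃ λ x → T (p x)
count-pos {suc N} p pos with p zero in p₀
... | true  = zero , subst T (sym p₀) tt
... | false with x , px ← count-pos (p ∘ suc) pos = suc x , px

listSum-tabulate : ∀ N (f : Fin N → ℕ) → List.sum (tabulate f) ≡ sum f
listSum-tabulate zero    f = refl
listSum-tabulate (suc N) f = cong (f zero +_) (listSum-tabulate N (f ∘ suc))

listSum-allFin : ∀ N (f : Fin N → ℕ) → List.sum (map f (allFin N)) ≡ sum f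
listSum-allFin N f = trans (cong List.sum (map-tabulate id f)) (listSum-tabulate N f)

count-not : ∀ {N} (p : Fin N → Bool) → count (not ∘ p) ≡ N ∸ count p
count-not {N} p = trans (sym (m+n∸m≡n (count p) _)) (cong (_∸ count p) (count-complement p))

count-interval : ∀ {n} lo hi → lo ≤ hi → hi ≤ n →
                 count (λ (i : Fin n) → interval lo hi (toℕ i)) ≡ hi ∸ lo
count-interval {zero}  zero          zero    _         _         = refl
count-interval {suc n} zero          zero    _         _         = count-interval {n} 0 0 z≤n z≤n
count-interval {suc n} zero          (suc h) _         (s≤s h≤n) = cong suc (count-interval {n} 0 h z≤n h≤n)
count-interval {suc n} (suc zero)    (suc h) (s≤s l≤h) (s≤s h≤n) = count-interval {n} 0 h l≤h h≤n
count-interval {suc n} (suc (suc l)) (suc h) (s≤s l≤h) (s≤s h≤n) = count-interval {n} (suc l) h l≤h h≤n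

-- Edge boundaries and cuts

crosses : ∀ {N} → Graph N → (Fin N → Bool) → Fin N → Fin N → Bool
crosses X A x y = A x ∧ not (A y) ∧ adj X x y

∂ : ∀ {N} → Graph N → (Fin N → Bool) → ℕ
∂ {N} X A = ∑[ x < N ] ∑[ y < N ] boolToℕ (crosses X A x y)

-- ∣_∣ₑ counts each edge {u, v} once, as the ordered pair with toℕ u ≤ toℕ v.
ordered : ∀ {N} → Fin N → Fin N → Bool
ordered u v = (toℕ u <ᵇ toℕ v) ∨ (toℕ u ≡ᵇ toℕ v)

size-as-sum : ∀ {N} {X : Graph N} (S : EdgeSet X) →
              ∣ S ∣ₑ ≡ ∑[ u < N ] ∑[ v < N ] boolToℕ (sel S u v ∧ ordered u v)
size-as-sum {N} S = trans (cong List.sum (map-cong (λ u → listSum-allFin N _) (allFin N))) (listSum-allFin N _)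

ordered-total : ∀ {N} {u v : Fin N} → u ≢ v → boolToℕ (ordered u v) + boolToℕ (ordered v u) ≡ 1
ordered-total {u = u} {v} u≢v = go (toℕ u) (toℕ v) (u≢v ∘ toℕ-injective)
  where
  go : ∀ m n → m ≢ n → boolToℕ ((m <ᵇ n) ∨ (m ≡ᵇ n)) + boolToℕ ((n <ᵇ m) ∨ (n ≡ᵇ m)) ≡ 1
  go zero    zero    m≢n = contradiction refl m≢n
  go zero    (suc n) m≢n = refl
  go (suc m) zero    m≢n = refl
  go (suc m) (suc n) m≢n = go m n (m≢n ∘ cong suc)

sum-oriented : ∀ {N} (c : Fin N → Fin N → Bool) → (∀ x → ¬ T (c x x)) →
               ∑[ x < N ] ∑[ y < N ] boolToℕ (c x y)
               ≡ ∑[ x < N ] ∑[ y < N ] (boolToℕ (c x y ∧ ordered x y) + boolToℕ (c y x ∧ ordered x y))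
sum-oriented {N} c irrefl = begin
  ∑[ x < N ] ∑[ y < N ] boolToℕ (c x y)
    ≡⟨ sum-cong-≗ (λ x → sum-cong-≗ (λ y → split x y)) ⟩
  ∑[ x < N ] ∑[ y < N ] (f x y + g y x)
    ≡⟨ sum-cong-≗ (λ x → ∑-distrib-+ (f x) (λ y → g y x)) ⟩
  ∑[ x < N ] (∑[ y < N ] f x y + ∑[ y < N ] g y x)
    ≡⟨ ∑-distrib-+ (λ x → ∑[ y < N ] f x y) (λ x → ∑[ y < N ] g y x) ⟩
  ∑[ x < N ] ∑[ y < N ] f x y + ∑[ x < N ] ∑[ y < N ] g y x
    ≡⟨ cong (∑[ x < N ] ∑[ y < N ] f x y +_) (∑-comm (λ x y → g y x)) ⟩
  ∑[ x < N ] ∑[ y < N ] f x y + ∑[ x < N ] ∑[ y < N ] g x y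
    ≡⟨ ∑-distrib-+ (λ x → ∑[ y < N ] f x y) (λ x → ∑[ y < N ] g x y) ⟨
  ∑[ x < N ] (∑[ y < N ] f x y + ∑[ y < N ] g x y)
    ≡⟨ sum-cong-≗ (λ x → ∑-distrib-+ (f x) (g x)) ⟨
  ∑[ x < N ] ∑[ y < N ] (f x y + g x y) ∎
  where
  open ≡-Reasoning
  f g : Fin N → Fin N → ℕ
  f x y = boolToℕ (c x y ∧ ordered x y)
  g x y = boolToℕ (c y x ∧ ordered x y)
  split : ∀ x y → boolToℕ (c x y) ≡ f x y + g y x
  split x y with c x y in cxy
  ... | false = refl
  ... | true  = sym (ordered-total {u = x} {v = y} λ { refl → irrefl x (subst T (sym cxy) tt) })

oriented-≤ : ∀ {c₁ c₂ s} o → (T c₁ → T s) → (T c₂ → T s) → (T c₁ → T c₂ → ⊥) →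
             boolToℕ (c₁ ∧ o) + boolToℕ (c₂ ∧ o) ≤ boolToℕ (s ∧ o)
oriented-≤ {false} {false}         o _  _  _    = z≤n
oriented-≤ {true}  {true}          o _  _  excl = ⊥-elim (excl tt tt)
oriented-≤ {true}  {false} {true}  o _  _  _    = ≤-reflexive (+-identityʳ _)
oriented-≤ {true}  {false} {false} o h₁ _  _    = ⊥-elim (h₁ tt)
oriented-≤ {false} {true}  {true}  o _  _  _    = ≤-refl
oriented-≤ {false} {true}  {false} o _  h₂ _    = ⊥-elim (h₂ tt)

oriented-≥ : ∀ {c₁ c₂ s} o → (T s → T c₁ ⊎ T c₂) →
             boolToℕ (s ∧ o) ≤ boolToℕ (c₁ ∧ o) + boolToℕ (c₂ ∧ o)
oriented-≥ {s = false}         o h = z≤n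
oriented-≥ {true}  {s = true}  o h = m≤m+n _ _
oriented-≥ {false} {true}  {true} o h = ≤-refl
oriented-≥ {false} {false} {true} o h with h tt
... | inj₁ ()
... | inj₂ ()

cutOf : ∀ {N} (X : Graph N) → (Fin N → Bool) → EdgeSet X
cutOf X A = record
  { sel    = λ u v → adj X u v ∧ (A u xor A v)
  ; sel-sym = λ u v → cong₂ _∧_ (adj-sym X u v) (xor-comm (A u) (A v))
  ; sel-⊆  = λ u v → proj₁ ∘ to T-∧
  }

module _ {N} (X : Graph N) (A : Fin N → Bool) where

  private
    c : Fin N → Fin N → Bool
    c = crosses X A

    c-irrefl : ∀ x → ¬ T (c x x)
    c-irrefl x with A x
    ... | true  = λ ()
    ... | false = λ ()

  ∂≤size : (S : EdgeSet X) → (∀ x y → T (A x) → T (not (A y)) → T (adj X x y) → T (sel S x y)) →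
           ∂ X A ≤ ∣ S ∣ₑ
  ∂≤size S S⊇∂ = begin
    ∂ X A ≡⟨ sum-oriented c c-irrefl ⟩
    ∑[ x < N ] ∑[ y < N ] (boolToℕ (c x y ∧ ordered x y) + boolToℕ (c y x ∧ ordered x y))
      ≤⟨ sum-mono-≤ (λ x → sum-mono-≤ (λ y →
           oriented-≤ (ordered x y) (in-S x y) (subst T (sel-sym S y x) ∘ in-S y x) (excl x y))) ⟩
    ∑[ x < N ] ∑[ y < N ] boolToℕ (sel S x y ∧ ordered x y) ≡⟨ size-as-sum S ⟨
    ∣ S ∣ₑ ∎
    where
    open ≤-Reasoning
    in-S : ∀ x y → T (c x y) → T (sel S x y)
    in-S x y cxy with Ax , ¬Ay∧xy ← to T-∧ cxy with ¬Ay , xy ← to T-∧ ¬Ay∧xy = S⊇∂ x y Ax ¬Ay xy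
    excl : ∀ x y → T (c x y) → T (c y x) → ⊥
    excl x y with A x | A y
    ... | true  | true  = λ ()
    ... | true  | false = λ _ ()
    ... | false | _     = λ ()

  size-cutOf : ∣ cutOf X A ∣ₑ ≡ ∂ X A
  size-cutOf = ≤-antisym (begin
    ∣ cutOf X A ∣ₑ ≡⟨ size-as-sum (cutOf X A) ⟩
    ∑[ x < N ] ∑[ y < N ] boolToℕ (sel (cutOf X A) x y ∧ ordered x y)
      ≤⟨ sum-mono-≤ (λ x → sum-mono-≤ (λ y → oriented-≥ (ordered x y) (crossing x y))) ⟩
    ∑[ x < N ] ∑[ y < N ] (boolToℕ (c x y ∧ ordered x y) + boolToℕ (c y x ∧ ordered x y))
      ≡⟨ sum-oriented c c-irrefl ⟨
    ∂ X A ∎)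
    (∂≤size (cutOf X A) crossing⁻)
    where
    open ≤-Reasoning
    crossing : ∀ x y → T (adj X x y ∧ (A x xor A y)) → T (c x y) ⊎ T (c y x)
    crossing x y s with xy , Ax≠Ay ← to T-∧ s with xor-cases (A x) (A y) Ax≠Ay
    ... | inj₁ (Ax , ¬Ay) = inj₁ (from T-∧ (Ax , from T-∧ (¬Ay , xy)))
    ... | inj₂ (Ay , ¬Ax) = inj₂ (from T-∧ (Ay , from T-∧ (¬Ax , subst T (adj-sym X x y) xy)))
    crossing⁻ : ∀ x y → T (A x) → T (not (A y)) → T (adj X x y) → T (sel (cutOf X A) x y)
    crossing⁻ x y Ax ¬Ay xy with A x | A y
    crossing⁻ x y Ax ¬Ay xy | true  | false = from T-∧ (xy , tt)
    crossing⁻ x y () ¬Ay xy | false | _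
    crossing⁻ x y Ax () xy  | true  | true

Reach-trans : ∀ {N} {X : Graph N} {u v w} → Reach X u v → Reach X v w → Reach X u w
Reach-trans here         r = r
Reach-trans (step uv r₁) r₂ = step uv (Reach-trans r₁ r₂)

Reach-sym : ∀ {N} {X : Graph N} {u v} → Reach X u v → Reach X v u
Reach-sym             here        = here
Reach-sym {X = X} {u} (step {v = w} uw r) = Reach-trans (Reach-sym r) (step (subst T (adj-sym X u w) uw) here)

edge : ∀ {N} {X : Graph N} {u v} → T (adj X u v) → Reach X u v
edge uv = step uv here

module _ {N} (X : Graph N) (A : Fin N → Bool) where

  cutOf-keeps : ∀ {x y} → T (adj X x y) → A x ≡ A y → T (adj (X ─ cutOf X A) x y)
  cutOf-keeps {x} {y} xy Ax≡Ay with adj X x y | A x | A y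
  cutOf-keeps xy refl | true | true  | true  = tt
  cutOf-keeps xy refl | true | false | false = tt

  cutOf-separates : ∀ {x y} → T (adj (X ─ cutOf X A) x y) → A x ≡ A y
  cutOf-separates {x} {y} xy with adj X x y | A x | A y
  cutOf-separates xy | true | true  | true  = refl
  cutOf-separates xy | true | false | false = refl

  Reach-cutOf : ∀ {x y} → Reach (X ─ cutOf X A) x y → A x ≡ A y
  Reach-cutOf here       = refl
  Reach-cutOf (step e r) = trans (cutOf-separates e) (Reach-cutOf r)

  cutOf-disconnects : ∀ {u v} → T (A u) → T (not (A v)) → Disconnected (X ─ cutOf X A)
  cutOf-disconnects {u} {v} Au ¬Av = u , v , λ r → contradiction (Reach-cutOf r) (different Au ¬Av)
    where
    different : ∀ {a b} → T a → T (not b) → a ≢ b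
    different {true} {false} _ _ ()

∂-≥-2 : ∀ {N} (X : Graph N) (A : Fin N → Bool) {x₁ y₁ x₂ y₂} →
        T (crosses X A x₁ y₁) → T (crosses X A x₂ y₂) →
        (x₁ ≡ x₂ → y₁ ≡ y₂ → ⊥) → 2 ≤ ∂ X A
∂-≥-2 {N} X A {x₁} {y₁} {x₂} {y₂} c₁ c₂ distinct with x₁ ≟ x₂
... | no x₁≢x₂ = begin
  1 + 1                   ≤⟨ +-mono-≤ (≤-trans (T⇒1≤boolToℕ c₁) (sum-≥-single y₁ (term x₁)))
                                      (≤-trans (T⇒1≤boolToℕ c₂) (sum-≥-single y₂ (term x₂))) ⟩
  sum (term x₁) + sum (term x₂) ≤⟨ sum-≥-pair (sum ∘ term) (x₁≢x₂ ∘ sym) ⟩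
  ∂ X A                   ∎
  where
  open ≤-Reasoning
  term : Fin N → Fin N → ℕ
  term x y = boolToℕ (crosses X A x y)
... | yes refl = begin
  1 + 1                   ≤⟨ +-mono-≤ (T⇒1≤boolToℕ c₁) (T⇒1≤boolToℕ c₂) ⟩
  term x₁ y₁ + term x₁ y₂ ≤⟨ sum-≥-pair (term x₁) (λ y₂≡y₁ → distinct refl (sym y₂≡y₁)) ⟩
  sum (term x₁)           ≤⟨ sum-≥-single x₁ (sum ∘ term) ⟩
  ∂ X A                   ∎
  where
  open ≤-Reasoning
  term : Fin N → Fin N → ℕ
  term x y = boolToℕ (crosses X A x y)

-- Restricted edge-connectivity from bipartitions

IsoperimetricBound : ∀ {N} → Graph N → ℕ → ℕ → Set
IsoperimetricBound {N} X j k =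
  ∀ (A : Fin N → Bool) → j ≤ count A → j ≤ count (not ∘ A) → k ≤ ∂ X A

¬¬-decidable : ∀ {N} (P : Fin N → Set) → ¬ ¬ (∀ x → Dec (P x))
¬¬-decidable {zero}  P ¬dec = ¬dec λ ()
¬¬-decidable {suc N} P ¬dec = ¬¬-excluded-middle λ P₀? →
  ¬¬-decidable (P ∘ suc) λ dec → ¬dec λ { zero → P₀? ; (suc x) → dec x }

-- Reachability in X ─ S is decidable only up to double negation here; since the goal is
-- decidable, it may be proved from a decision procedure for reachability from u.
restrictedCut-≥ : ∀ {N} {X : Graph N} {j k} → IsoperimetricBound X j k →
                  ∀ S → IsRestrictedEdgeCut X j S → k ≤ ∣ S ∣ₑ
restrictedCut-≥ {N} {X} {j} {k} bound S ((u , v , u↛v) , big) =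
  decidable-stable (k ≤? ∣ S ∣ₑ) λ k≰S → ¬¬-decidable (Reach (X ─ S) u) (k≰S ∘ viaComponent)
  where
  viaComponent : (∀ x → Dec (Reach (X ─ S) u x)) → k ≤ ∣ S ∣ₑ
  viaComponent u⇝? = ≤-trans (bound A inside outside) (∂≤size X A S leaves)
    where
    A : Fin N → Bool
    A x = isYes (u⇝? x)
    inside : j ≤ count A
    inside with f , f-inj , u⇝f ← big u =
      sum-≥-injective (boolToℕ ∘ A) f f-inj (λ i → T⇒1≤boolToℕ (fromWitness {a? = u⇝? (f i)} (u⇝f i)))
    outside : j ≤ count (not ∘ A)
    outside with f , f-inj , v⇝f ← big v =
      sum-≥-injective (boolToℕ ∘ not ∘ A) f f-inj
        (λ i → T⇒1≤boolToℕ (fromWitnessFalse {a? = u⇝? (f i)}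
                                λ u⇝fi → u↛v (Reach-trans u⇝fi (Reach-sym (v⇝f i)))))
    leaves : ∀ x y → T (A x) → T (not (A y)) → T (adj X x y) → T (sel S x y)
    leaves x y Ax ¬Ay xy with sel S x y in xy∈S
    ... | true  = tt
    ... | false = toWitnessFalse {a? = u⇝? y} ¬Ay
                    (Reach-trans (toWitness {a? = u⇝? x} Ax) (edge (from T-∧ (xy , subst (T ∘ not) (sym xy∈S) tt))))

module _ {N} {X : Graph N} {j k} (bound : IsoperimetricBound X j k) (A : Fin N → Bool) {u v}
         (Au : T (A u)) (¬Av : T (not (A v))) where

  restrictedEdgeConn : ComponentsAtLeast (X ─ cutOf X A) j → ∂ X A ≤ k → RestrictedEdgeConnEq X j k
  restrictedEdgeConn big ∂≤k =
    (cutOf X A , cut , ≤-antisym (subst (_≤ k) (sym (size-cutOf X A)) ∂≤k) (restrictedCut-≥ bound (cutOf X A) cut))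
    , restrictedCut-≥ bound
    where cut = cutOf-disconnects X A Au ¬Av , big

components≥1 : ∀ {N} (Y : Graph N) → ComponentsAtLeast Y 1
components≥1 Y v = (λ _ → v) , (λ { {zero} {zero} _ → refl }) , (λ _ → here)

edgeConn : ∀ {N} {X : Graph N} {k} → IsoperimetricBound X 1 k → (A : Fin N → Bool) → ∀ {u v} →
           T (A u) → T (not (A v)) → ∂ X A ≤ k → EdgeConnEq X k
edgeConn {X = X} bound A Au ¬Av ∂≤k
  with (S , (cut , _) , size) , lower ← restrictedEdgeConn bound A Au ¬Av (components≥1 _) ∂≤k =
  (S , cut , size) , λ S′ cut′ → lower S′ (cut′ , components≥1 _)

Reaches : ∀ {N} → Graph N → ℕ → Fin N → Set
Reaches {N} Y j h = Σ (Fin j → Fin N) λ f → Injective _≡_ _≡_ f × (∀ i → Reach Y h (f i))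

components-viaHubs : ∀ {N} {Y : Graph N} {j} (class : Fin N → Bool) (hub : Bool → Fin N) →
                     (∀ v → Reach Y v (hub (class v))) → (∀ b → Reaches Y j (hub b)) →
                     ComponentsAtLeast Y j
components-viaHubs class hub v⇝hub hub⇝ v with f , f-inj , hub⇝f ← hub⇝ (class v) =
  f , f-inj , λ i → Reach-trans (v⇝hub v) (hub⇝f i)

∷-injective : ∀ {N n} {a : Fin N} {f : Fin n → Fin N} →
              (∀ i → f i ≢ a) → Injective _≡_ _≡_ f → Injective _≡_ _≡_ (a ∷ f)
∷-injective f≢a f-inj {zero}  {zero}  _ = refl
∷-injective f≢a f-inj {zero}  {suc j} e = contradiction (sym e) (f≢a j)
∷-injective f≢a f-inj {suc i} {zero}  e = contradiction e (f≢a i)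
∷-injective f≢a f-inj {suc i} {suc j} e = cong suc (f-inj e)

reaches₂ : ∀ {N} {Y : Graph N} {h a b} → b ≢ a → Reach Y h a → Reach Y h b → Reaches Y 2 h
reaches₂ {a = a} {b} b≢a h⇝a h⇝b =
  (a ∷ b ∷ []) , ∷-injective (λ { zero → b≢a ; (suc ()) }) (∷-injective (λ ()) (λ { {()} })) ,
  λ { zero → h⇝a ; (suc zero) → h⇝b }

reaches₃ : ∀ {N} {Y : Graph N} {h a b c} → b ≢ a → c ≢ a → c ≢ b →
           Reach Y h a → Reach Y h b → Reach Y h c → Reaches Y 3 h
reaches₃ {a = a} {b} {c} b≢a c≢a c≢b h⇝a h⇝b h⇝c =
  (a ∷ b ∷ c ∷ []) ,
  ∷-injective (λ { zero → b≢a ; (suc zero) → c≢a ; (suc (suc ())) })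
    (∷-injective (λ { zero → c≢b ; (suc ()) }) (∷-injective (λ ()) (λ { {()} }))) ,
  λ { zero → h⇝a ; (suc zero) → h⇝b ; (suc (suc zero)) → h⇝c }

Reaches-≤ : ∀ {N} {Y : Graph N} {j k h} → j ≤ k → Reaches Y k h → Reaches Y j h
Reaches-≤ j≤k (f , f-inj , h⇝f) =
  (λ i → f (inject≤ i j≤k)) ,
  (λ {x} {y} e → inject≤-injective j≤k j≤k x y (f-inj e)) ,
  (λ i → h⇝f (inject≤ i j≤k))

ComponentsAtLeast-≤ : ∀ {N} {Y : Graph N} {j k} → j ≤ k → ComponentsAtLeast Y k → ComponentsAtLeast Y j
ComponentsAtLeast-≤ j≤k big = Reaches-≤ j≤k ∘ big

-- The product K₂ × H

adj-⊗ : ∀ {m n} (G : Graph m) (H : Graph n) s i t j →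
        adj (G ⊗ H) (combine s i) (combine t j) ≡ adj G s t ∧ adj H i j
adj-⊗ {m} {n} G H s i t j = cong₂ _∧_ (cong₂ (adj G) (quotient-combine s i) (quotient-combine t j))
                                (cong₂ (adj H) (remainder-combine s i) (remainder-combine t j))
  where
  quotient-combine : ∀ (s : Fin m) (i : Fin n) → quotient n (combine s i) ≡ s
  quotient-combine s i = cong proj₁ (remQuot-combine s i)
  remainder-combine : ∀ (s : Fin m) (i : Fin n) → remainder {m} n (combine s i) ≡ i
  remainder-combine s i = cong proj₂ (remQuot-combine s i)

module Halves (n : ℕ) where

  L R : Fin n → Fin (2 * n)
  L = combine {2} zero
  R = combine {2} (suc zero)

  L≢R : ∀ {i j} → L i ≢ R j
  L≢R {i} {j} e with () ← combine-injectiveˡ {2} zero i (suc zero) j e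

  L-injective : ∀ {i j} → L i ≡ L j → i ≡ j
  L-injective {i} {j} = combine-injectiveʳ {2} zero i zero j

  vertex-cases : ∀ x → (∃ λ i → x ≡ L i) ⊎ (∃ λ i → x ≡ R i)
  vertex-cases x = cases (remQuot {2} n x) (combine-remQuot {2} n x)
    where
    cases : ∀ si → uncurry combine si ≡ x → (∃ λ i → x ≡ L i) ⊎ (∃ λ i → x ≡ R i)
    cases (zero     , i) Li≡x = inj₁ (i , sym Li≡x)
    cases (suc zero , i) Ri≡x = inj₂ (i , sym Ri≡x)

  sum-vertices : (f : Fin (2 * n) → ℕ) → sum f ≡ ∑[ i < n ] f (L i) + ∑[ i < n ] f (R i)
  sum-vertices f = trans (sum-combine 2 n f) (cong (∑[ i < n ] f (L i) +_) (+-identityʳ _))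

  count-vertices : (A : Fin (2 * n) → Bool) → count A ≡ count (A ∘ L) + count (A ∘ R)
  count-vertices A = sum-vertices (boolToℕ ∘ A)

module _ {n : ℕ} where
  open Halves n

  crossingsBetween : Graph n → (Fin n → Bool) → (Fin n → Bool) → ℕ
  crossingsBetween H p q = ∑[ i < n ] ∑[ j < n ] boolToℕ (p i ∧ not (q j) ∧ adj H i j)

  ∂-K₂⊗ : ∀ (H : Graph n) (A : Fin (2 * n) → Bool) →
          ∂ (K 2 ⊗ H) A ≡ crossingsBetween H (A ∘ L) (A ∘ R) + crossingsBetween H (A ∘ R) (A ∘ L)
  ∂-K₂⊗ H A = begin
    ∂ (K 2 ⊗ H) A
      ≡⟨ sum-vertices _ ⟩
    ∑[ i < n ] ∑[ y < 2 * n ] g (L i) y + ∑[ i < n ] ∑[ y < 2 * n ] g (R i) y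
      ≡⟨ cong₂ _+_ (sum-cong-≗ λ i → sum-vertices (g (L i))) (sum-cong-≗ λ i → sum-vertices (g (R i))) ⟩
    ∑[ i < n ] (∑[ j < n ] g (L i) (L j) + ∑[ j < n ] g (L i) (R j))
      + ∑[ i < n ] (∑[ j < n ] g (R i) (L j) + ∑[ j < n ] g (R i) (R j))
      ≡⟨ cong₂ _+_
           (sum-cong-≗ λ i → cong₂ _+_ (no-edges zero i) (sum-cong-≗ λ j → edge-term zero i (suc zero) j))
           (sum-cong-≗ λ i → trans (cong₂ _+_ (sum-cong-≗ λ j → edge-term (suc zero) i zero j) (no-edges (suc zero) i))
                                   (+-identityʳ _)) ⟩
    crossingsBetween H (A ∘ L) (A ∘ R) + crossingsBetween H (A ∘ R) (A ∘ L) ∎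
    where
    open ≡-Reasoning
    g : Fin (2 * n) → Fin (2 * n) → ℕ
    g x y = boolToℕ (A x ∧ not (A y) ∧ adj (K 2 ⊗ H) x y)
    edge-term : ∀ (s : Fin 2) i t j → g (combine s i) (combine t j)
                ≡ boolToℕ (A (combine s i) ∧ not (A (combine t j)) ∧ (adj (K 2) s t ∧ adj H i j))
    edge-term s i t j =
      cong (λ e → boolToℕ (A (combine s i) ∧ not (A (combine t j)) ∧ e)) (adj-⊗ (K 2) H s i t j)
    no-edges : ∀ (s : Fin 2) i → ∑[ j < n ] g (combine s i) (combine s j) ≡ 0
    no-edges s i =
      trans (sum-cong-≗ λ j → trans (edge-term s i s j) (vanish (A (combine s i)) (not (A (combine s j))) s))
            (sum-replicate-zero n)
      where
      vanish : ∀ a b (s : Fin 2) {e} → boolToℕ (a ∧ b ∧ (adj (K 2) s s ∧ e)) ≡ 0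
      vanish false b     s          = refl
      vanish true  false s          = refl
      vanish true  true  zero       = refl
      vanish true  true  (suc zero) = refl

  crossingsBetween-T' : ∀ p q → crossingsBetween (T' n) p q ≡ count p * count (not ∘ q)
  crossingsBetween-T' p q = trans (sum-cong-≗ λ i → sum-cong-≗ λ j → cong (boolToℕ ∘ (p i ∧_)) (∧-identityʳ (not (q j))))
                          (count-∧ p (not ∘ q))

  adj-K-irrefl : ∀ i → adj (K n) i i ≡ false
  adj-K-irrefl i = cong not (to T-≡ (≡⇒≡ᵇ (toℕ i) (toℕ i) refl))

  adj-K-≢ : ∀ {i j} → i ≢ j → T (adj (K n) i j)
  adj-K-≢ {i} {j} i≢j with toℕ i ≡ᵇ toℕ j in i≡ᵇj
  ... | false = tt
  ... | true  = contradiction (toℕ-injective (≡ᵇ⇒≡ (toℕ i) (toℕ j) (subst T (sym i≡ᵇj) tt))) i≢j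

  crossingsBetween-K : ∀ p q →
                       crossingsBetween (K n) p q + count (λ i → p i ∧ not (q i)) ≡ count p * count (not ∘ q)
  crossingsBetween-K p q = begin
    crossingsBetween (K n) p q + count (λ i → p i ∧ not (q i))
      ≡⟨ ∑-distrib-+ (λ i → ∑[ j < n ] boolToℕ (p i ∧ not (q j) ∧ adj (K n) i j))
                     (λ i → boolToℕ (p i ∧ not (q i))) ⟨
    ∑[ i < n ] (∑[ j < n ] boolToℕ (p i ∧ not (q j) ∧ adj (K n) i j) + boolToℕ (p i ∧ not (q i)))
      ≡⟨ sum-cong-≗ (λ i → row i (p i) (not ∘ q)) ⟩
    ∑[ i < n ] ∑[ j < n ] boolToℕ (p i ∧ not (q j))
      ≡⟨ count-∧ p (not ∘ q) ⟩
    count p * count (not ∘ q) ∎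
    where
    open ≡-Reasoning
    off-split-twins : ∀ i b (h : Fin n → Bool) j →
                   boolToℕ (b ∧ h j ∧ adj (K n) i j) ≡ except i (λ j → boolToℕ (b ∧ h j)) j
    off-split-twins i b h j with j ≟ i
    ... | yes refl = begin
      boolToℕ (b ∧ h i ∧ adj (K n) i i) ≡⟨ cong (λ e → boolToℕ (b ∧ h i ∧ e)) (adj-K-irrefl i) ⟩
      boolToℕ (b ∧ h i ∧ false)         ≡⟨ cong (boolToℕ ∘ (b ∧_)) (∧-zeroʳ (h i)) ⟩
      boolToℕ (b ∧ false)               ≡⟨ cong boolToℕ (∧-zeroʳ b) ⟩
      0                                 ∎
    ... | no  j≢i  = begin
      boolToℕ (b ∧ h j ∧ adj (K n) i j) ≡⟨ cong (λ e → boolToℕ (b ∧ h j ∧ e)) (to T-≡ (adj-K-≢ (j≢i ∘ sym))) ⟩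
      boolToℕ (b ∧ h j ∧ true)          ≡⟨ cong (boolToℕ ∘ (b ∧_)) (∧-identityʳ (h j)) ⟩
      boolToℕ (b ∧ h j)                 ∎
    row : ∀ i b (h : Fin n → Bool) →
          ∑[ j < n ] boolToℕ (b ∧ h j ∧ adj (K n) i j) + boolToℕ (b ∧ h i) ≡ ∑[ j < n ] boolToℕ (b ∧ h j)
    row i b h = begin
      ∑[ j < n ] boolToℕ (b ∧ h j ∧ adj (K n) i j) + boolToℕ (b ∧ h i)
        ≡⟨ +-comm _ (boolToℕ (b ∧ h i)) ⟩
      boolToℕ (b ∧ h i) + ∑[ j < n ] boolToℕ (b ∧ h j ∧ adj (K n) i j)
        ≡⟨ cong (boolToℕ (b ∧ h i) +_) (sum-cong-≗ (off-split-twins i b h)) ⟩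
      boolToℕ (b ∧ h i) + sum (except i (λ j → boolToℕ (b ∧ h j)))
        ≡⟨ sum-except i (λ j → boolToℕ (b ∧ h j)) ⟨
      ∑[ j < n ] boolToℕ (b ∧ h j) ∎

module Sides {n : ℕ} (A : Fin (2 * n) → Bool) where
  open Halves n

  Aˡ Aʳ : Fin n → Bool
  Aˡ = A ∘ L
  Aʳ = A ∘ R

  a b a′ b′ s s′ : ℕ
  a = count Aˡ
  b = count Aʳ
  a′ = count (not ∘ Aˡ)
  b′ = count (not ∘ Aʳ)
  s = count A
  s′ = count (not ∘ A)

  sizes-vs-sides : s * s′ ≤ 2 * (a * b′ + b * a′)
  sizes-vs-sides = subst₂ (λ x y → x * y ≤ 2 * (a * b′ + b * a′))
                          (sym (count-vertices A)) (sym (count-vertices (not ∘ A)))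
                          (cross-≥ a a′ b b′ (trans (count-complement Aˡ) (sym (count-complement Aʳ))))

  scaled-sizes : ∀ j → 2 * (j * n) ≡ j * (s + s′)
  scaled-sizes j = trans (reorder j n) (cong (j *_) (sym (count-complement A)))
    where
    reorder : ∀ j n → 2 * (j * n) ≡ j * (2 * n)
    reorder = solve-∀

  ∂-K₂⊗T : ∂ (K 2 ⊗ T' n) A ≡ a * b′ + b * a′
  ∂-K₂⊗T = trans (∂-K₂⊗ (T' n) A) (cong₂ _+_ (crossingsBetween-T' Aˡ Aʳ) (crossingsBetween-T' Aʳ Aˡ))

  split-twins : ℕ
  split-twins = count (λ i → Aˡ i ∧ not (Aʳ i)) + count (λ i → Aʳ i ∧ not (Aˡ i))

  ∂-K₂⊗K : ∂ (K 2 ⊗ K n) A + split-twins ≡ a * b′ + b * a′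
  ∂-K₂⊗K = begin
    ∂ (K 2 ⊗ K n) A + split-twins
      ≡⟨ cong (_+ split-twins) (∂-K₂⊗ (K n) A) ⟩
    (crossingsBetween (K n) Aˡ Aʳ + crossingsBetween (K n) Aʳ Aˡ) + split-twins
      ≡⟨ interchange (crossingsBetween (K n) Aˡ Aʳ) _ _ _ ⟩
    (crossingsBetween (K n) Aˡ Aʳ + count (λ i → Aˡ i ∧ not (Aʳ i)))
      + (crossingsBetween (K n) Aʳ Aˡ + count (λ i → Aʳ i ∧ not (Aˡ i)))
      ≡⟨ cong₂ _+_ (crossingsBetween-K Aˡ Aʳ) (crossingsBetween-K Aʳ Aˡ) ⟩
    a * b′ + b * a′ ∎
    where open ≡-Reasoning

  split-twins≤s : split-twins ≤ s
  split-twins≤s = subst (split-twins ≤_) (sym (count-vertices A))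
    (+-mono-≤ (sum-mono-≤ λ i → ∧-≤ˡ (Aˡ i) _) (sum-mono-≤ λ i → ∧-≤ˡ (Aʳ i) _))

  split-twins≤s′ : split-twins ≤ s′
  split-twins≤s′ = subst (split-twins ≤_) (trans (+-comm b′ a′) (sym (count-vertices (not ∘ A))))
    (+-mono-≤ (sum-mono-≤ λ i → ∧-≤ʳ (Aˡ i) _) (sum-mono-≤ λ i → ∧-≤ʳ (Aʳ i) _))

T-isoperimetric : ∀ {n} j d → j * j ≤ suc (2 * d) → IsoperimetricBound (K 2 ⊗ T' n) j (j * n ∸ d)
T-isoperimetric {n} j d jj≤ A j≤s j≤s′ = halve-∸ (j * n) (∂ (K 2 ⊗ T' n) A) d (begin
  2 * (j * n)                         ≡⟨ scaled-sizes j ⟩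
  j * (s + s′)                        ≤⟨ product-≥ j s s′ j≤s j≤s′ ⟩
  s * s′ + j * j                      ≤⟨ +-mono-≤ sizes-vs-sides jj≤ ⟩
  2 * (a * b′ + b * a′) + suc (2 * d) ≡⟨ cong (λ c → 2 * c + suc (2 * d)) ∂-K₂⊗T ⟨
  2 * ∂ (K 2 ⊗ T' n) A + suc (2 * d)  ∎)
  where
  open ≤-Reasoning
  open Sides {n} A

K-isoperimetric : ∀ {n} j d → j + 2 ≤ n → j * j + 2 * j ≤ suc (2 * d) →
                  IsoperimetricBound (K 2 ⊗ K n) j (j * n ∸ d)
K-isoperimetric {n} j d j+2≤n bound A j≤s j≤s′ = halve-∸ (j * n) c d (begin
  2 * (j * n)                 ≡⟨ scaled-sizes j ⟩
  j * (s + s′)                ≤⟨ larger-side ⟩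
  2 * c + j * j + 2 * j       ≡⟨ +-assoc (2 * c) (j * j) (2 * j) ⟩
  2 * c + (j * j + 2 * j)     ≤⟨ +-monoʳ-≤ (2 * c) bound ⟩
  2 * c + suc (2 * d)         ∎)
  where
  open ≤-Reasoning
  open Sides {n} A
  c = ∂ (K 2 ⊗ K n) A
  ss′≤ : s * s′ ≤ 2 * c + 2 * split-twins
  ss′≤ = begin
    s * s′                    ≤⟨ sizes-vs-sides ⟩
    2 * (a * b′ + b * a′)     ≡⟨ cong (2 *_) ∂-K₂⊗K ⟨
    2 * (c + split-twins)     ≡⟨ *-distribˡ-+ 2 c split-twins ⟩
    2 * c + 2 * split-twins   ∎
  smaller-first : ∀ {x y} → x ≤ y → x + y ≡ 2 * n → j ≤ x → x * y ≤ 2 * c + 2 * x →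
                  j * (x + y) ≤ 2 * c + j * j + 2 * j
  smaller-first {x} {y} x≤y x+y≡2n j≤x xy≤ =
    product-≥-shifted j x y c j≤x (≤-trans j+2≤n (larger-≥-half x y n x≤y x+y≡2n)) xy≤
  larger-side : j * (s + s′) ≤ 2 * c + j * j + 2 * j
  larger-side with ≤-total s s′
  ... | inj₁ s≤s′ = smaller-first s≤s′ (count-complement A) j≤s
                      (≤-trans ss′≤ (+-monoʳ-≤ (2 * c) (*-monoʳ-≤ 2 split-twins≤s)))
  ... | inj₂ s′≤s = subst (_≤ 2 * c + j * j + 2 * j) (cong (j *_) (+-comm s′ s))
                      (smaller-first s′≤s (trans (+-comm s′ s) (count-complement A)) j≤s′
                        (subst (_≤ 2 * c + 2 * s′) (*-comm s s′)
                               (≤-trans ss′≤ (+-monoʳ-≤ (2 * c) (*-monoʳ-≤ 2 split-twins≤s′)))))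

left-disjoint : ∀ p q x → interval 0 p x ∧ not (interval p (p + q) x) ≡ interval 0 p x
left-disjoint zero          q x       = refl
left-disjoint (suc p)       q zero    = refl
left-disjoint (suc zero)    q (suc x) = refl
left-disjoint (suc (suc p)) q (suc x) = left-disjoint (suc p) q x

right-disjoint : ∀ p q x → interval p (p + q) x ∧ not (interval 0 p x) ≡ interval p (p + q) x
right-disjoint zero          q x       = ∧-identityʳ _
right-disjoint (suc p)       q zero    = refl
right-disjoint (suc zero)    q (suc x) = right-disjoint zero q x
right-disjoint (suc (suc p)) q (suc x) = right-disjoint (suc p) q x

segment : ∀ {n} → ℕ → ℕ → Fin 2 → Fin n → Bool
segment p q zero       i = interval 0 p (toℕ i)
segment p q (suc zero) i = interval p (p + q) (toℕ i)

segments : ∀ n → ℕ → ℕ → Fin (2 * n) → Bool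
segments n p q = uncurry (segment p q) ∘ remQuot {2} n

module _ {n : ℕ} where
  open Halves n

  segments-L : ∀ p q i → segments n p q (L i) ≡ interval 0 p (toℕ i)
  segments-L p q i = cong (uncurry (segment p q)) (remQuot-combine {2} zero i)

  segments-R : ∀ p q i → segments n p q (R i) ≡ interval p (p + q) (toℕ i)
  segments-R p q i = cong (uncurry (segment p q)) (remQuot-combine {2} (suc zero) i)

  module _ p q (p+q≤n : p + q ≤ n) where
    open Sides {n} (segments n p q)

    private
      count-left : count (λ (i : Fin n) → interval 0 p (toℕ i)) ≡ p
      count-left = count-interval 0 p z≤n (≤-trans (m≤m+n p q) p+q≤n)
      count-right : count (λ (i : Fin n) → interval p (p + q) (toℕ i)) ≡ q
      count-right = trans (count-interval p (p + q) (m≤m+n p q) p+q≤n) (m+n∸m≡n p q)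
      left : count Aˡ ≡ p
      left = trans (sum-cong-≗ (λ i → cong boolToℕ (segments-L p q i))) count-left
      right : count Aʳ ≡ q
      right = trans (sum-cong-≗ (λ i → cong boolToℕ (segments-R p q i))) count-right
      sides : a * b′ + b * a′ ≡ p * (n ∸ q) + q * (n ∸ p)
      sides = cong₂ _+_ (cong₂ _*_ left (trans (count-not Aʳ) (cong (n ∸_) right)))
                        (cong₂ _*_ right (trans (count-not Aˡ) (cong (n ∸_) left)))

    ∂-K₂⊗T-segments : ∂ (K 2 ⊗ T' n) (segments n p q) ≡ p * (n ∸ q) + q * (n ∸ p)
    ∂-K₂⊗T-segments = trans ∂-K₂⊗T sides

    ∂-K₂⊗K-segments : ∂ (K 2 ⊗ K n) (segments n p q) + (p + q) ≡ p * (n ∸ q) + q * (n ∸ p)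
    ∂-K₂⊗K-segments = trans (cong (∂ (K 2 ⊗ K n) (segments n p q) +_) (sym split-twins≡)) (trans ∂-K₂⊗K sides)
      where
      only-left : ∀ i → Aˡ i ∧ not (Aʳ i) ≡ interval 0 p (toℕ i)
      only-left i = trans (cong₂ (λ x y → x ∧ not y) (segments-L p q i) (segments-R p q i)) (left-disjoint p q (toℕ i))
      only-right : ∀ i → Aʳ i ∧ not (Aˡ i) ≡ interval p (p + q) (toℕ i)
      only-right i = trans (cong₂ (λ x y → x ∧ not y) (segments-R p q i) (segments-L p q i)) (right-disjoint p q (toℕ i))
      split-twins≡ : split-twins ≡ p + q
      split-twins≡ = cong₂ _+_ (trans (sum-cong-≗ (λ i → cong boolToℕ (only-left i))) count-left)
                            (trans (sum-cong-≗ (λ i → cong boolToℕ (only-right i))) count-right)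

module _ {m} (H : Graph (5 + m)) (K⊆H : ∀ {i j} → i ≢ j → T (adj H i j)) where
  private
    n = 5 + m
  open Halves n

  module _ (A : Fin (2 * n) → Bool) where
    private
      X Y : Graph (2 * n)
      X = K 2 ⊗ H
      Y = X ─ cutOf X A

    link-LR : ∀ {i j} → i ≢ j → A (L i) ≡ A (R j) → Reach Y (L i) (R j)
    link-LR {i} {j} i≢j same =
      edge (cutOf-keeps X A (subst T (sym (adj-⊗ (K 2) H zero i (suc zero) j)) (K⊆H i≢j)) same)

    link-RL : ∀ {i j} → i ≢ j → A (R i) ≡ A (L j) → Reach Y (R i) (L j)
    link-RL {i} {j} i≢j same =
      edge (cutOf-keeps X A (subst T (sym (adj-⊗ (K 2) H (suc zero) i zero j)) (K⊆H i≢j)) same)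

    module _ (L₀ : A (L zero) ≡ true) (R₀ : A (R zero) ≡ false)
             (L₃ : A (L (# 3)) ≡ false) (L₄ : A (L (# 4)) ≡ false) where

      class-reaches : ∀ h → A (R h) ≡ true → A (L h) ≡ false → ∀ v → A v ≡ true → Reach Y v (R h)
      class-reaches h Rh Lh v Av with vertex-cases v
      ... | inj₁ (i , refl) = link-LR (λ { refl → clash Av Lh }) (trans Av (sym Rh))
      ... | inj₂ (i , refl) = Reach-trans (link-RL (λ { refl → clash Av R₀ }) (trans Av (sym L₀)))
                                          (link-LR (λ { refl → clash Rh R₀ }) (trans L₀ (sym Rh)))

      R-via-L : ∀ {i k} → i ≢ k → A (R i) ≡ false → A (L k) ≡ false → Reach Y (R i) (R zero)
      R-via-L i≢k Ri Lk = Reach-trans (link-RL i≢k (trans Ri (sym Lk)))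
                                      (link-LR (λ { refl → clash L₀ Lk }) (trans Lk (sym R₀)))

      complement-reaches : ∀ v → A v ≡ false → Reach Y v (R zero)
      complement-reaches v Av with vertex-cases v
      ... | inj₁ (i , refl) = link-LR (λ { refl → clash L₀ Av }) (trans Av (sym R₀))
      ... | inj₂ (i , refl) with i ≟ zero | i ≟ # 3
      ...   | yes refl | _        = here
      ...   | no  _    | yes refl = R-via-L (λ ()) Av L₄
      ...   | no  _    | no  i≢3  = R-via-L i≢3 Av L₃

      complement-spread : Reaches Y 3 (R zero)
      complement-spread =
        reaches₃ L≢R L≢R (λ e → contradiction (L-injective e) λ ()) here
          (link-RL {j = # 3} (λ ()) (trans R₀ (sym L₃))) (link-RL {j = # 4} (λ ()) (trans R₀ (sym L₄)))

      components-viaR : ∀ h → A (R h) ≡ true → A (L h) ≡ false → ∀ {j} → j ≤ 3 → Reaches Y j (R h) →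
                        ComponentsAtLeast Y j
      components-viaR h Rh Lh j≤3 spread = components-viaHubs A hub reaches spreads
        where
        hub : Bool → Fin (2 * n)
        hub true  = R h
        hub false = R zero
        reaches : ∀ v → Reach Y v (hub (A v))
        reaches v with A v in Av
        ... | true  = class-reaches h Rh Lh v Av
        ... | false = complement-reaches v Av
        spreads : ∀ b → Reaches Y _ (hub b)
        spreads true  = spread
        spreads false = Reaches-≤ j≤3 complement-spread

  segments-components₂ : ComponentsAtLeast ((K 2 ⊗ H) ─ cutOf (K 2 ⊗ H) (segments n 1 1)) 2
  segments-components₂ =
    components-viaR A (at-L zero) (at-R zero) (at-L (# 3)) (at-L (# 4)) (# 1) (at-R (# 1)) (at-L (# 1)) (s≤s (s≤s z≤n))
      (reaches₂ L≢R here (link-RL A {j = zero} (λ ()) (trans (at-R (# 1)) (sym (at-L zero)))))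
    where
    A = segments n 1 1
    at-L = segments-L {n} 1 1
    at-R = segments-R {n} 1 1

  segments-components₃ : ComponentsAtLeast ((K 2 ⊗ H) ─ cutOf (K 2 ⊗ H) (segments n 2 1)) 3
  segments-components₃ =
    components-viaR A (at-L zero) (at-R zero) (at-L (# 3)) (at-L (# 4)) (# 2) (at-R (# 2)) (at-L (# 2)) ≤-refl
      (reaches₃ L≢R L≢R (λ e → contradiction (L-injective e) λ ()) here
        (link-RL A {j = zero} (λ ()) (trans (at-R (# 2)) (sym (at-L zero))))
        (link-RL A {j = # 1} (λ ()) (trans (at-R (# 2)) (sym (at-L (# 1))))))
    where
    A = segments n 2 1
    at-L = segments-L {n} 2 1
    at-R = segments-R {n} 2 1

-- Cycles

-- vertexAt runs around a Hamiltonian cycle of X with period N, position is its inverse, and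
-- adj-vertexAt⇒ says that X has no edges besides those of the cycle.
record IsCycle {N} .{{_ : NonZero N}} (X : Graph N) : Set where
  field
    vertexAt : ℕ → Fin N
    position : Fin N → ℕ
    vertexAt-position : ∀ x → vertexAt (position x) ≡ x
    position-vertexAt : ∀ t → position (vertexAt t) ≡ t % N
    adj-vertexAt : ∀ t → T (adj X (vertexAt t) (vertexAt (suc t)))
    adj-vertexAt⇒ : ∀ t y → T (adj X (vertexAt (suc t)) y) → y ≡ vertexAt t ⊎ y ≡ vertexAt (2 + t)

first-value-change : ∀ (α : ℕ → Bool) {b} s d → α s ≡ b → α (s + d) ≢ b →
                     ∃ λ p → α p ≡ b × α (suc p) ≢ b
first-value-change α s zero    αs≡b αs+0≢b =
  contradiction (subst (λ t → α t ≡ _) (sym (+-identityʳ s)) αs≡b) αs+0≢b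
first-value-change α {b} s (suc d) αs≡b αend≢b with α (suc s) ≟ᵇ b
... | yes αs+1≡b = first-value-change α (suc s) d αs+1≡b (αend≢b ∘ subst (λ t → α t ≡ b) (sym (+-suc s d)))
... | no  αs+1≢b = s , αs≡b , αs+1≢b

value-change : ∀ (α : ℕ → Bool) {b} s t → s ≤ t → α s ≡ b → α t ≢ b →
               ∃ λ p → α p ≡ b × α (suc p) ≢ b
value-change α s t s≤t with d , refl ← m≤n⇒∃[o]m+o≡n s≤t = first-value-change α s d

module _ {N} .{{_ : NonZero N}} {X : Graph N} (cycle : IsCycle X) where
  open IsCycle cycle

  vertexAt-% : ∀ t → vertexAt (t % N) ≡ vertexAt t
  vertexAt-% t = trans (cong vertexAt (sym (position-vertexAt t))) (vertexAt-position (vertexAt t))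

  vertexAt-cong : ∀ {a b} → a % N ≡ b % N → vertexAt a ≡ vertexAt b
  vertexAt-cong {a} {b} e = trans (sym (vertexAt-% a)) (trans (cong vertexAt e) (vertexAt-% b))

  vertexAt-injective : ∀ {a b} → vertexAt a ≡ vertexAt b → a % N ≡ b % N
  vertexAt-injective {a} {b} e = trans (sym (position-vertexAt a)) (trans (cong position e) (position-vertexAt b))

  position-< : ∀ x → position x < N
  position-< x = subst (_< N) (trans (sym (position-vertexAt (position x))) (cong position (vertexAt-position x)))
                        (m%n<n _ N)

  vertexAt-periodic : ∀ x k → vertexAt (position x + k * N) ≡ x
  vertexAt-periodic x k = trans (vertexAt-cong ([m+kn]%n≡m%n (position x) k N)) (vertexAt-position x)

  time-≤ : ∀ x y k → position x + k * N ≤ position y + suc k * N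
  time-≤ x y k = ≤-trans (<⇒≤ (+-monoˡ-< (k * N) (position-< x))) (m≤n+m (suc k * N) (position y))

  -- Going around from u past v and back to u, the walk leaves A at some step p and re-enters it
  -- at a later step p′; the two crossings differ because on a cycle of length at least 3 the
  -- walk never runs back along the edge it has just used.
  ∂-cycle-≥ : 3 ≤ N → (A : Fin N → Bool) → ∀ {u v} → T (A u) → T (not (A v)) → 2 ≤ ∂ X A
  ∂-cycle-≥ 3≤N A {u} {v} Au ¬Av = crossings
    (value-change α (time u 0) (time v 1) (time-≤ u v 0) (α-at u 0 Au′) (λ e → clash e (α-at v 1 ¬Av′)))
    (value-change α (time v 1) (time u 2) (time-≤ v u 1) (α-at v 1 ¬Av′) (λ e → clash (α-at u 2 Au′) e))
    where
    α : ℕ → Bool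
    α = A ∘ vertexAt
    time : Fin N → ℕ → ℕ
    time x k = position x + k * N
    α-at : ∀ x k {b} → A x ≡ b → α (time x k) ≡ b
    α-at x k Ax≡b = trans (cong A (vertexAt-periodic x k)) Ax≡b
    Au′ : A u ≡ true
    Au′ = to T-≡ Au
    ¬Av′ : A v ≡ false
    ¬Av′ = to T-not-≡ ¬Av
    crossings : (∃ λ p → α p ≡ true × α (suc p) ≢ true) → (∃ λ p → α p ≡ false × α (suc p) ≢ false) →
                2 ≤ ∂ X A
    crossings (p , αp , αp+1) (p′ , αp′ , αp′+1) = ∂-≥-2 X A leave enter distinct
      where
      leave : T (crosses X A (vertexAt p) (vertexAt (suc p)))
      leave = from T-∧ (from T-≡ αp , from T-∧ (≢true αp+1 , adj-vertexAt p))
      enter : T (crosses X A (vertexAt (suc p′)) (vertexAt p′))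
      enter = from T-∧ (≢false αp′+1 , from T-∧ (from T-not-≡ αp′ , subst T (adj-sym X _ _) (adj-vertexAt p′)))
      distinct : vertexAt p ≡ vertexAt (suc p′) → vertexAt (suc p) ≡ vertexAt p′ → ⊥
      distinct e₁ e₂ =
        2+-%-≢ p′ 3≤N (vertexAt-injective (trans (vertexAt-cong (+-%-cong 1 (vertexAt-injective (sym e₁)))) e₂))

  cycle-isoperimetric : 3 ≤ N → ∀ j → 1 ≤ j → IsoperimetricBound X j 2
  cycle-isoperimetric 3≤N j 1≤j A inside outside
    with u , Au ← count-pos A (≤-trans 1≤j inside) | v , ¬Av ← count-pos (not ∘ A) (≤-trans 1≤j outside) =
    ∂-cycle-≥ 3≤N A Au ¬Av

  walk : (A : Fin N → Bool) → ∀ a d {b} → (∀ t → a ≤ t → t ≤ a + d → A (vertexAt t) ≡ b) →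
         Reach (X ─ cutOf X A) (vertexAt a) (vertexAt (a + d))
  walk A a zero    const = subst (Reach (X ─ cutOf X A) (vertexAt a) ∘ vertexAt) (sym (+-identityʳ a)) here
  walk A a (suc d) const =
    step (cutOf-keeps X A (adj-vertexAt a) (trans (const a ≤-refl (m≤m+n a _)) (sym (const (suc a) (n≤1+n a) a+1≤end))))
         (subst (Reach (X ─ cutOf X A) (vertexAt (suc a)) ∘ vertexAt) (sym (+-suc a d))
                (walk A (suc a) d λ t a+1≤t t≤end →
                  const t (≤-trans (n≤1+n a) a+1≤t) (≤-trans t≤end (≤-reflexive (sym (+-suc a d))))))
    where
    a+1≤end : suc a ≤ a + suc d
    a+1≤end = ≤-trans (s≤s (m≤m+n a d)) (≤-reflexive (sym (+-suc a d)))

  row-vanishes : (A : Fin N → Bool) → ∀ x → A x ≡ false → ∑[ y < N ] boolToℕ (crosses X A x y) ≡ 0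
  row-vanishes A x Ax≡false =
    trans (sum-cong-≗ λ y → cong (λ b → boolToℕ (b ∧ not (A y) ∧ adj X x y)) Ax≡false) (sum-replicate-zero N)

  row-≤-neighbours : (A : Fin N → Bool) → ∀ s →
                     ∑[ y < N ] boolToℕ (crosses X A (vertexAt (suc s)) y)
                     ≤ boolToℕ (not (A (vertexAt s))) + (boolToℕ (not (A (vertexAt (2 + s)))) + 0)
  row-≤-neighbours A s = begin
    sum (term (vertexAt (suc s)))
      ≤⟨ sum-≤-support (term (vertexAt (suc s))) (vertexAt s ∷ vertexAt (2 + s) ∷ []) neighbour ⟩
    term (vertexAt (suc s)) (vertexAt s) + (term (vertexAt (suc s)) (vertexAt (2 + s)) + 0)
      ≤⟨ +-mono-≤ (∧-≤-middle (A (vertexAt (suc s))) (not (A (vertexAt s))) _)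
                  (+-monoˡ-≤ 0 (∧-≤-middle (A (vertexAt (suc s))) (not (A (vertexAt (2 + s)))) _)) ⟩
    boolToℕ (not (A (vertexAt s))) + (boolToℕ (not (A (vertexAt (2 + s)))) + 0) ∎
    where
    open ≤-Reasoning
    term : Fin N → Fin N → ℕ
    term x y = boolToℕ (crosses X A x y)
    neighbour : ∀ y → term (vertexAt (suc s)) y ≢ 0 → ∃ λ i → (vertexAt s ∷ vertexAt (2 + s) ∷ []) i ≡ y
    neighbour y term≢0 with adj-vertexAt⇒ s y (∧-last {A (vertexAt (suc s))} {not (A y)} term≢0)
    ... | inj₁ y≡s   = zero , sym y≡s
    ... | inj₂ y≡2+s = suc zero , sym y≡2+s

  module _ (6≤N : 6 ≤ N) where

    arc : Fin N → Bool
    arc x = interval 1 4 (position x)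

    private
      Y : Graph N
      Y = X ─ cutOf X arc

      early : ∀ {t} → t < 6 → t < N
      early t<6 = ≤-trans t<6 6≤N

      arc-at : ∀ t → t < N → arc (vertexAt t) ≡ interval 1 4 t
      arc-at t t<N = cong (interval 1 4) (trans (position-vertexAt t) (m<n⇒m%n≡m t<N))

      vertexAt-N : vertexAt N ≡ vertexAt 0
      vertexAt-N = vertexAt-cong (trans (n%n≡0 N) (sym (m<n⇒m%n≡m (early (s≤s z≤n)))))

      position-injective : ∀ {s t} → s < N → t < N → vertexAt s ≡ vertexAt t → s ≡ t
      position-injective {s} {t} s<N t<N e = trans (sym (m<n⇒m%n≡m s<N)) (trans (vertexAt-injective e) (m<n⇒m%n≡m t<N))

      distinct : ∀ s t {_ : T (s <ᵇ 6)} {_ : T (t <ᵇ 6)} → s ≢ t → vertexAt s ≢ vertexAt t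
      distinct s t {s<6} {t<6} s≢t e = s≢t (position-injective (early (<ᵇ⇒< s 6 s<6)) (early (<ᵇ⇒< t 6 t<6)) e)

      at : ∀ {x t} → position x ≡ t → vertexAt t ≡ x
      at {x} p≡t = trans (cong vertexAt (sym p≡t)) (vertexAt-position x)

    on-arc : ∀ t → 1 ≤ t → t ≤ 3 → arc (vertexAt t) ≡ true
    on-arc t 1≤t t≤3 = trans (arc-at t (early (s≤s (≤-trans t≤3 (s≤s (s≤s (s≤s z≤n))))))) (inside t 1≤t t≤3)
      where
      inside : ∀ t → 1 ≤ t → t ≤ 3 → interval 1 4 t ≡ true
      inside 1 _ _ = refl
      inside 2 _ _ = refl
      inside 3 _ _ = refl
      inside (suc (suc (suc (suc _)))) _ (s≤s (s≤s (s≤s ())))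

    off-arc : ∀ t → 4 ≤ t → t ≤ N → arc (vertexAt t) ≡ false
    off-arc t 4≤t t≤N with m≤n⇒m<n∨m≡n t≤N
    ... | inj₁ t<N  = trans (arc-at t t<N) (interval-1-4-≥4 t 4≤t)
    ... | inj₂ refl = trans (cong arc vertexAt-N) (arc-at 0 (early (s≤s z≤n)))

    ∂-arc : ∂ X arc ≤ 2
    ∂-arc = begin
      ∂ X arc
        ≤⟨ sum-≤-support _ (vertexAt 1 ∷ vertexAt 2 ∷ vertexAt 3 ∷ []) row-support ⟩
      row (vertexAt 1) + (row (vertexAt 2) + (row (vertexAt 3) + 0))
        ≤⟨ +-mono-≤ (row-≤ 0 (early (s≤s (s≤s (s≤s z≤n)))))
                    (+-mono-≤ (row-≤ 1 (early (s≤s (s≤s (s≤s (s≤s z≤n))))))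
                              (+-mono-≤ (row-≤ 2 (early (s≤s (s≤s (s≤s (s≤s (s≤s z≤n))))))) ≤-refl)) ⟩
      2 ∎
      where
      open ≤-Reasoning
      row : Fin N → ℕ
      row x = ∑[ y < N ] boolToℕ (crosses X arc x y)
      row-support : ∀ x → row x ≢ 0 → ∃ λ i → (vertexAt 1 ∷ vertexAt 2 ∷ vertexAt 3 ∷ []) i ≡ x
      row-support x row≢0 = by-arc (arc x) refl
        where
        by-arc : ∀ b → arc x ≡ b → ∃ λ i → (vertexAt 1 ∷ vertexAt 2 ∷ vertexAt 3 ∷ []) i ≡ x
        by-arc false arc-x = contradiction (row-vanishes arc x arc-x) row≢0
        by-arc true  arc-x with interval-1-4-∋ (position x) arc-x
        ... | inj₁ p≡1        = zero , at p≡1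
        ... | inj₂ (inj₁ p≡2) = suc zero , at p≡2
        ... | inj₂ (inj₂ p≡3) = suc (suc zero) , at p≡3
      row-≤ : ∀ s → 2 + s < N →
              row (vertexAt (suc s)) ≤ boolToℕ (not (interval 1 4 s)) + (boolToℕ (not (interval 1 4 (2 + s))) + 0)
      row-≤ s 2+s<N = subst₂ (λ a b → row (vertexAt (suc s)) ≤ boolToℕ (not a) + (boolToℕ (not b) + 0))
                             (arc-at s (<-trans (n<1+n s) (<-trans (n<1+n _) 2+s<N))) (arc-at (2 + s) 2+s<N)
                             (row-≤-neighbours arc s)

    arc-components : ComponentsAtLeast (X ─ cutOf X arc) 3
    arc-components = components-viaHubs arc hub reaches spread
      where
      hub : Bool → Fin N
      hub true  = vertexAt 1
      hub false = vertexAt 4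
      along-arc : ∀ d → d ≤ 2 → Reach Y (vertexAt 1) (vertexAt (1 + d))
      along-arc d d≤2 = walk arc 1 d λ t 1≤t t≤1+d → on-arc t 1≤t (≤-trans t≤1+d (s≤s d≤2))
      along-rest : ∀ d → 4 + d ≤ N → Reach Y (vertexAt 4) (vertexAt (4 + d))
      along-rest d 4+d≤N = walk arc 4 d λ t 4≤t t≤4+d → off-arc t 4≤t (≤-trans t≤4+d 4+d≤N)
      to-start : Reach Y (vertexAt 4) (vertexAt 0)
      to-start with e , 4+e≡N ← m≤n⇒∃[o]m+o≡n (≤-trans (m≤m+n 4 2) 6≤N) =
        subst (Reach Y (vertexAt 4)) (trans (cong vertexAt 4+e≡N) vertexAt-N) (along-rest e (≤-reflexive 4+e≡N))
      reaches : ∀ v → Reach Y v (hub (arc v))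
      reaches v = by-arc (arc v) refl
        where
        by-arc : ∀ b → arc v ≡ b → Reach Y v (hub b)
        by-arc true arc-v with interval-1-4-∋ (position v) arc-v
        ... | inj₁ p≡1        = subst (λ x → Reach Y x (vertexAt 1)) (at p≡1) here
        ... | inj₂ (inj₁ p≡2) = subst (λ x → Reach Y x (vertexAt 1)) (at p≡2) (Reach-sym (along-arc 1 (s≤s z≤n)))
        ... | inj₂ (inj₂ p≡3) = subst (λ x → Reach Y x (vertexAt 1)) (at p≡3) (Reach-sym (along-arc 2 ≤-refl))
        by-arc false arc-v with interval-1-4-∌ (position v) arc-v
        ... | inj₁ p≡0   = subst (λ x → Reach Y x (vertexAt 4)) (at p≡0) (Reach-sym to-start)
        ... | inj₂ 4≤p with d , 4+d≡p ← m≤n⇒∃[o]m+o≡n 4≤p =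
          subst (λ x → Reach Y x (vertexAt 4)) (at (sym 4+d≡p))
                (Reach-sym (along-rest d (≤-trans (≤-reflexive 4+d≡p) (<⇒≤ (position-< v)))))
      spread : ∀ b → Reaches Y 3 (hub b)
      spread true  = reaches₃ (distinct 2 1 λ ()) (distinct 3 1 λ ()) (distinct 3 2 λ ())
                              here (along-arc 1 (s≤s z≤n)) (along-arc 2 ≤-refl)
      spread false = reaches₃ (distinct 5 4 λ ()) (distinct 0 4 λ ()) (distinct 0 5 λ ())
                              here (along-rest 1 (≤-trans (m≤m+n 5 1) 6≤N)) to-start

-- K₂ × Cₙ is a cycle for odd n

side : Parity → Fin 2
side 0ℙ = zero
side 1ℙ = suc zero

parityOf : Fin 2 → Parity
parityOf zero       = 0ℙ
parityOf (suc zero) = 1ℙ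

parityOf-side : ∀ p → parityOf (side p) ≡ p
parityOf-side 0ℙ = refl
parityOf-side 1ℙ = refl

side-parityOf : ∀ s → side (parityOf s) ≡ s
side-parityOf zero       = refl
side-parityOf (suc zero) = refl

adj-K₂-side : ∀ p → T (adj (K 2) (side p) (side (p ⁻¹)))
adj-K₂-side 0ℙ = _
adj-K₂-side 1ℙ = _

adj-K₂-side⇒ : ∀ p s → T (adj (K 2) (side p) s) → s ≡ side (p ⁻¹)
adj-K₂-side⇒ 0ℙ zero       ()
adj-K₂-side⇒ 0ℙ (suc zero) _  = refl
adj-K₂-side⇒ 1ℙ zero       _  = refl
adj-K₂-side⇒ 1ℙ (suc zero) ()

≢⇒⁻¹ : ∀ {p q : Parity} → p ≢ q → p ⁻¹ ≡ q
≢⇒⁻¹ {0ℙ} {0ℙ} p≢q = contradiction refl p≢q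
≢⇒⁻¹ {0ℙ} {1ℙ} _   = refl
≢⇒⁻¹ {1ℙ} {0ℙ} _   = refl
≢⇒⁻¹ {1ℙ} {1ℙ} p≢q = contradiction refl p≢q

parity-suc : ∀ t → parity (suc t) ≡ parity t ⁻¹
parity-suc t = trans (sym (⁻¹-involutive (parity (suc t)))) (cong _⁻¹ (suc-homo-⁻¹ t))

module Prism (k : ℕ) where
  n : ℕ
  n = suc (2 * k)

  parity-n : parity n ≡ 1ℙ
  parity-n = trans (parity-suc (2 * k)) (cong _⁻¹ (*-homo-* 2 k))

  parity-+n : ∀ t → parity (t + n) ≡ parity t ⁻¹
  parity-+n t = trans (+-homo-+ t n) (trans (cong (parity t ℙ.+_) parity-n) (ℙₚ.+-comm (parity t) 1ℙ))

  parity-% : ∀ t → parity (t % (2 * n)) ≡ parity t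
  parity-% t = sym (begin
    parity t                                ≡⟨ cong parity (m≡m%n+[m/n]*n t (2 * n)) ⟩
    parity (r + q * (2 * n))                ≡⟨ +-homo-+ r (q * (2 * n)) ⟩
    parity r ℙ.+ parity (q * (2 * n))       ≡⟨ cong (λ m → parity r ℙ.+ parity m) (even q n) ⟩
    parity r ℙ.+ parity (2 * (q * n))       ≡⟨ cong (parity r ℙ.+_) (*-homo-* 2 (q * n)) ⟩
    parity r ℙ.+ 0ℙ                         ≡⟨ ℙₚ.+-identityʳ (parity r) ⟩
    parity r                                ∎)
    where
    open ≡-Reasoning
    r = t % (2 * n)
    q = t / (2 * n)
    even : ∀ q n → q * (2 * n) ≡ 2 * (q * n)
    even = solve-∀

  toℕ-mod : ∀ t → toℕ (t mod n) ≡ t % n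
  toℕ-mod t = toℕ-fromℕ< (m%n<n t n)

  mod-≡ : ∀ t {i : Fin n} → t % n ≡ toℕ i → t mod n ≡ i
  mod-≡ t e = toℕ-injective (trans (toℕ-mod t) e)

  toℕ-mod-id : ∀ (i : Fin n) → toℕ i mod n ≡ i
  toℕ-mod-id i = mod-≡ (toℕ i) (m<n⇒m%n≡m (toℕ<n i))

  vertexAt : ℕ → Fin (2 * n)
  vertexAt t = combine (side (parity t)) (t mod n)

  -- The t < 2n with t ≡ toℕ i (mod n) and parity t = parityOf s, which exists as n is odd.
  time : Fin 2 → Fin n → ℕ
  time s i with parity (toℕ i) ≟ℙ parityOf s
  ... | yes _ = toℕ i
  ... | no  _ = toℕ i + n

  time-≡ : ∀ {s i} → parity (toℕ i) ≡ parityOf s → time s i ≡ toℕ i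
  time-≡ {s} {i} e with parity (toℕ i) ≟ℙ parityOf s
  ... | yes _ = refl
  ... | no ne = contradiction e ne

  time-≢ : ∀ {s i} → parity (toℕ i) ≢ parityOf s → time s i ≡ toℕ i + n
  time-≢ {s} {i} ne with parity (toℕ i) ≟ℙ parityOf s
  ... | yes e = contradiction e ne
  ... | no  _ = refl

  position : Fin (2 * n) → ℕ
  position = uncurry time ∘ remQuot n

  position-combine : ∀ s i → position (combine s i) ≡ time s i
  position-combine s i = cong (uncurry time) (remQuot-combine s i)

  vertexAt-time : ∀ s i → vertexAt (time s i) ≡ combine s i
  vertexAt-time s i with parity (toℕ i) ≟ℙ parityOf s
  ... | yes p≡s = cong₂ combine (trans (cong side p≡s) (side-parityOf s)) (toℕ-mod-id i)
  ... | no  p≢s = cong₂ combine (trans (cong side (trans (parity-+n (toℕ i)) (≢⇒⁻¹ p≢s))) (side-parityOf s))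
                                (mod-≡ (toℕ i + n) (trans ([m+n]%n≡m%n (toℕ i) n) (m<n⇒m%n≡m (toℕ<n i))))

  vertexAt-position : ∀ x → vertexAt (position x) ≡ x
  vertexAt-position x = trans (uncurry vertexAt-time (remQuot {2} n x)) (combine-remQuot {2} n x)

  time-vertexAt : ∀ t → time (side (parity t)) (t mod n) ≡ t % (2 * n)
  time-vertexAt t with t % (2 * n) <? n
  ... | yes r<n = trans (time-≡ same-parity) index≡r
    where
    index≡r : toℕ (t mod n) ≡ t % (2 * n)
    index≡r = begin
      toℕ (t mod n)        ≡⟨ toℕ-mod t ⟩
      t % n                ≡⟨ m∣n⇒o%n%m≡o%m n (2 * n) t (divides 2 refl) ⟨
      t % (2 * n) % n      ≡⟨ m<n⇒m%n≡m r<n ⟩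
      t % (2 * n)          ∎
      where open ≡-Reasoning
    same-parity : parity (toℕ (t mod n)) ≡ parityOf (side (parity t))
    same-parity = trans (cong parity index≡r) (trans (parity-% t) (sym (parityOf-side (parity t))))
  ... | no r≮n with r′ , n+r′≡r ← m≤n⇒∃[o]m+o≡n (≮⇒≥ r≮n) =
    trans (time-≢ other-parity) (trans (cong (_+ n) index≡r′) (trans (+-comm r′ n) n+r′≡r))
    where
    r′<n : r′ < n
    r′<n = +-cancelˡ-< n r′ n (subst (_< n + n) (sym n+r′≡r)
                                     (subst (t % (2 * n) <_) (cong (n +_) (+-identityʳ n)) (m%n<n t (2 * n))))
    index≡r′ : toℕ (t mod n) ≡ r′
    index≡r′ = begin
      toℕ (t mod n)        ≡⟨ toℕ-mod t ⟩
      t % n                ≡⟨ m∣n⇒o%n%m≡o%m n (2 * n) t (divides 2 refl) ⟨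
      t % (2 * n) % n      ≡⟨ cong (_% n) (trans (sym n+r′≡r) (+-comm n r′)) ⟩
      (r′ + n) % n         ≡⟨ [m+n]%n≡m%n r′ n ⟩
      r′ % n               ≡⟨ m<n⇒m%n≡m r′<n ⟩
      r′                   ∎
      where open ≡-Reasoning
    other-parity : parity (toℕ (t mod n)) ≢ parityOf (side (parity t))
    other-parity e = p≢p⁻¹ (parity r′) (begin
      parity r′                  ≡⟨ cong parity index≡r′ ⟨
      parity (toℕ (t mod n))     ≡⟨ e ⟩
      parityOf (side (parity t)) ≡⟨ parityOf-side (parity t) ⟩
      parity t                   ≡⟨ parity-% t ⟨
      parity (t % (2 * n))       ≡⟨ cong parity (trans (sym n+r′≡r) (+-comm n r′)) ⟩
      parity (r′ + n)            ≡⟨ parity-+n r′ ⟩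
      parity r′ ⁻¹               ∎)
      where open ≡-Reasoning

  position-vertexAt : ∀ t → position (vertexAt t) ≡ t % (2 * n)
  position-vertexAt t = trans (position-combine (side (parity t)) (t mod n)) (time-vertexAt t)

  X : Graph (2 * n)
  X = K 2 ⊗ C n

  suc-mod : ∀ t → suc (toℕ (t mod n)) % n ≡ suc t % n
  suc-mod t = trans (cong (λ r → suc r % n) (toℕ-mod t)) (+-%-cong 1 {N = n} (m%n%n≡m%n t n))

  adj-vertexAt : ∀ t → T (adj X (vertexAt t) (vertexAt (suc t)))
  adj-vertexAt t = subst T (sym (adj-⊗ (K 2) (C n) (side (parity t)) (t mod n) (side (parity (suc t))) (suc t mod n)))
    (from T-∧ (other-side , from T-∨ (inj₁ successor)))
    where
    other-side : T (adj (K 2) (side (parity t)) (side (parity (suc t))))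
    other-side = subst (λ p → T (adj (K 2) (side (parity t)) (side p))) (sym (parity-suc t)) (adj-K₂-side (parity t))
    successor : T (suc (toℕ (t mod n)) % n ≡ᵇ toℕ (suc t mod n))
    successor = ≡⇒≡ᵇ (suc (toℕ (t mod n)) % n) (toℕ (suc t mod n)) (trans (suc-mod t) (sym (toℕ-mod (suc t))))

  adj-vertexAt⇒ : ∀ t y → T (adj X (vertexAt (suc t)) y) → y ≡ vertexAt t ⊎ y ≡ vertexAt (2 + t)
  adj-vertexAt⇒ t y = neighbour (remQuot {2} n y) (combine-remQuot {2} n y)
    where
    neighbour : ∀ sj → uncurry combine sj ≡ y → T (adj X (vertexAt (suc t)) y) →
                y ≡ vertexAt t ⊎ y ≡ vertexAt (2 + t)
    neighbour (s , j) refl a with to T-∧ (subst T (adj-⊗ (K 2) (C n) (side (parity (suc t))) (suc t mod n) s j) a)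
    ... | k₂ , c with trans (adj-K₂-side⇒ (parity (suc t)) s k₂) (cong side (suc-homo-⁻¹ t))
                 | to (T-∨ {suc (toℕ (suc t mod n)) % n ≡ᵇ toℕ j} {suc (toℕ j) % n ≡ᵇ toℕ (suc t mod n)}) c
    ...   | refl | inj₁ forward = inj₂ (cong (combine (side (parity t))) (sym (mod-≡ (2 + t) (begin
      (2 + t) % n                       ≡⟨ suc-mod (suc t) ⟨
      suc (toℕ (suc t mod n)) % n       ≡⟨ ≡ᵇ⇒≡ (suc (toℕ (suc t mod n)) % n) (toℕ j) forward ⟩
      toℕ j                             ∎))))
      where open ≡-Reasoning
    ...   | refl | inj₂ backward = inj₁ (cong (combine (side (parity t))) (sym (mod-≡ t (sym (begin
      toℕ j                             ≡⟨ m<n⇒m%n≡m (toℕ<n j) ⟨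
      toℕ j % n                         ≡⟨ suc-%-injective {M = 2 * k}
                                             (trans (≡ᵇ⇒≡ (suc (toℕ j) % n) (toℕ (suc t mod n)) backward) (toℕ-mod (suc t))) ⟩
      t % n                             ∎)))))
      where open ≡-Reasoning

  isCycle : IsCycle X
  isCycle = record
    { vertexAt = vertexAt
    ; position = position
    ; vertexAt-position = vertexAt-position
    ; position-vertexAt = position-vertexAt
    ; adj-vertexAt = adj-vertexAt
    ; adj-vertexAt⇒ = adj-vertexAt⇒
    }

module _ (m : ℕ) where
  private
    n = 5 + m
  open Halves n

  private
    segments-edgeConn : ∀ {H : Graph n} {k} p q → IsoperimetricBound (K 2 ⊗ H) 1 k →
                        ∂ (K 2 ⊗ H) (segments n (suc p) q) ≡ k → EdgeConnEq (K 2 ⊗ H) k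
    segments-edgeConn p q bound ∂≡k =
      edgeConn bound (segments n (suc p) q) {L zero} {R zero}
        (from T-≡ (segments-L {n} (suc p) q zero)) (from T-not-≡ (segments-R {n} (suc p) q zero)) (≤-reflexive ∂≡k)

    segments-restricted : ∀ {H : Graph n} {j k} p q → IsoperimetricBound (K 2 ⊗ H) j k →
                          ComponentsAtLeast ((K 2 ⊗ H) ─ cutOf (K 2 ⊗ H) (segments n (suc p) q)) j →
                          ∂ (K 2 ⊗ H) (segments n (suc p) q) ≡ k → RestrictedEdgeConnEq (K 2 ⊗ H) j k
    segments-restricted p q bound big ∂≡k =
      restrictedEdgeConn bound (segments n (suc p) q) {L zero} {R zero}
        (from T-≡ (segments-L {n} (suc p) q zero)) (from T-not-≡ (segments-R {n} (suc p) q zero)) big (≤-reflexive ∂≡k)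

  K₂⊗T-connectivity : EdgeConnEq (K 2 ⊗ T' n) n
                      × RestrictedEdgeConnEq (K 2 ⊗ T' n) 2 (2 * n ∸ 2)
                      × RestrictedEdgeConnEq (K 2 ⊗ T' n) 3 (3 * n ∸ 4)
  K₂⊗T-connectivity =
      segments-edgeConn {H = T' n} 0 0
        (subst (IsoperimetricBound (K 2 ⊗ T' n) 1) (*-identityˡ n) (T-isoperimetric {n} 1 0 ≤-refl))
        (trans (∂-K₂⊗T-segments {n} 1 0 (m≤m+n 1 _)) (∂₁ m))
    , segments-restricted {H = T' n} 0 1 (T-isoperimetric {n} 2 2 (≤ᵇ⇒≤ 4 5 _))
        (segments-components₂ (T' n) (λ _ → tt))
        (trans (∂-K₂⊗T-segments {n} 1 1 (m≤m+n 2 _)) (sym (∸-≡ {b = 2} (∂₂ m))))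
    , segments-restricted {H = T' n} 1 1 (T-isoperimetric {n} 3 4 ≤-refl)
        (segments-components₃ (T' n) (λ _ → tt))
        (trans (∂-K₂⊗T-segments {n} 2 1 (m≤m+n 3 _)) (sym (∸-≡ {b = 4} (∂₃ m))))
    where
    ∂₁ : ∀ m → 1 * (5 + m) + 0 * (4 + m) ≡ 5 + m
    ∂₁ = solve-∀
    ∂₂ : ∀ m → 2 * (5 + m) ≡ 2 + (1 * (4 + m) + 1 * (4 + m))
    ∂₂ = solve-∀
    ∂₃ : ∀ m → 3 * (5 + m) ≡ 4 + (2 * (4 + m) + 1 * (3 + m))
    ∂₃ = solve-∀

  K₂⊗K-connectivity : EdgeConnEq (K 2 ⊗ K n) (n ∸ 1)
                      × RestrictedEdgeConnEq (K 2 ⊗ K n) 2 (2 * n ∸ 4)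
                      × RestrictedEdgeConnEq (K 2 ⊗ K n) 3 (3 * n ∸ 7)
  K₂⊗K-connectivity =
      segments-edgeConn {H = K n} 0 0 (subst (IsoperimetricBound (K 2 ⊗ K n) 1) (cong (_∸ 1) (*-identityˡ n))
                                   (K-isoperimetric {n} 1 1 (m≤m+n 3 _) ≤-refl))
        (cancel (∂-K₂⊗K-segments {n} 1 0 (m≤m+n 1 _)) (∂₁ m))
    , segments-restricted {H = K n} 0 1 (K-isoperimetric {n} 2 4 (m≤m+n 4 _) (≤ᵇ⇒≤ 8 9 _))
        (segments-components₂ (K n) adj-K-≢)
        (cancel (∂-K₂⊗K-segments {n} 1 1 (m≤m+n 2 _)) (trans (cong (_+ 2) (∸-≡ {b = 4} (2n∸4 m))) (∂₂ m)))
    , segments-restricted {H = K n} 1 1 (K-isoperimetric {n} 3 7 (m≤m+n 5 _) ≤-refl)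
        (segments-components₃ (K n) adj-K-≢)
        (cancel (∂-K₂⊗K-segments {n} 2 1 (m≤m+n 3 _)) (trans (cong (_+ 3) (∸-≡ {b = 7} (3n∸7 m))) (∂₃ m)))
    where
    cancel : ∀ {c k d r} → c + d ≡ r → k + d ≡ r → c ≡ k
    cancel {c} {k} {d} c+d≡r k+d≡r = +-cancelʳ-≡ d c k (trans c+d≡r (sym k+d≡r))
    ∂₁ : ∀ m → (4 + m) + (1 + 0) ≡ 1 * (5 + m) + 0 * (4 + m)
    ∂₁ = solve-∀
    2n∸4 : ∀ m → 2 * (5 + m) ≡ 4 + (6 + 2 * m)
    2n∸4 = solve-∀
    ∂₂ : ∀ m → (6 + 2 * m) + 2 ≡ 1 * (4 + m) + 1 * (4 + m)
    ∂₂ = solve-∀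
    3n∸7 : ∀ m → 3 * (5 + m) ≡ 7 + (8 + 3 * m)
    3n∸7 = solve-∀
    ∂₃ : ∀ m → (8 + 3 * m) + 3 ≡ 2 * (4 + m) + 1 * (3 + m)
    ∂₃ = solve-∀

K₂⊗C-connectivity : ∀ k → 1 ≤ k →
                    EdgeConnEq (K 2 ⊗ C (suc (2 * k))) 2
                    × RestrictedEdgeConnEq (K 2 ⊗ C (suc (2 * k))) 2 2
                    × RestrictedEdgeConnEq (K 2 ⊗ C (suc (2 * k))) 3 2
K₂⊗C-connectivity k 1≤k =
    edgeConn (bound 1 ≤-refl) A {vertexAt 1} {vertexAt 4} on off (∂-arc isCycle 6≤2n)
  , restrictedEdgeConn (bound 2 (s≤s z≤n)) A {vertexAt 1} {vertexAt 4} on off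
      (ComponentsAtLeast-≤ (s≤s (s≤s z≤n)) (arc-components isCycle 6≤2n)) (∂-arc isCycle 6≤2n)
  , restrictedEdgeConn (bound 3 (s≤s z≤n)) A {vertexAt 1} {vertexAt 4} on off
      (arc-components isCycle 6≤2n) (∂-arc isCycle 6≤2n)
  where
  open Prism k
  6≤2n : 6 ≤ 2 * n
  6≤2n = *-monoʳ-≤ 2 (s≤s (*-monoʳ-≤ 2 1≤k))
  bound : ∀ j → 1 ≤ j → IsoperimetricBound (K 2 ⊗ C n) j 2
  bound = cycle-isoperimetric isCycle (≤-trans (m≤m+n 3 3) 6≤2n)
  A : Fin (2 * n) → Bool
  A = arc isCycle 6≤2n
  on : T (A (vertexAt 1))
  on = from T-≡ (on-arc isCycle 6≤2n 1 ≤-refl (s≤s z≤n))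
  off : T (not (A (vertexAt 4)))
  off = from T-not-≡ (off-arc isCycle 6≤2n 4 ≤-refl (≤-trans (m≤m+n 4 2) 6≤2n))

lemma2p7 : ((n : ℕ) → 3 ≤ n → Odd n →
                EdgeConnEq (K 2 ⊗ C n) 2
                × RestrictedEdgeConnEq (K 2 ⊗ C n) 2 2
                × RestrictedEdgeConnEq (K 2 ⊗ C n) 3 2)
             × ((n : ℕ) → 5 ≤ n →
                EdgeConnEq (K 2 ⊗ K n) (n ∸ 1)
                × RestrictedEdgeConnEq (K 2 ⊗ K n) 2 (2 * n ∸ 4)
                × RestrictedEdgeConnEq (K 2 ⊗ K n) 3 (3 * n ∸ 7))
             × ((n : ℕ) → 5 ≤ n →
                EdgeConnEq (K 2 ⊗ T' n) n
                × RestrictedEdgeConnEq (K 2 ⊗ T' n) 2 (2 * n ∸ 2)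
                × RestrictedEdgeConnEq (K 2 ⊗ T' n) 3 (3 * n ∸ 4))
lemma2p7 =
    (λ { n 3≤n (k , refl) → K₂⊗C-connectivity k (*-cancelˡ-≤ 2 (≤-pred 3≤n)) })
  , from-5 K₂⊗K-connectivity
  , from-5 K₂⊗T-connectivity
  where
  from-5 : {P : ℕ → Set} → (∀ m → P (5 + m)) → ∀ n → 5 ≤ n → P n
  from-5 P₅₊ n 5≤n with m , refl ← m≤n⇒∃[o]m+o≡n 5≤n = P₅₊ m
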